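{- Let $t\ge 1$ and $n\ge 2t$ be integers. A nonempty subset $D\subseteq S_n$ is a $t$-design in $(S_n,d_S)$ if and only if, for every $k\in\{1,\dots,t\}$, $$\sum_{i=1}^n f_i\bigl(\widehat{C_k}(0)-\widehat{C_k}(i)\bigr)=\widehat{C_k}(0),$$ where $\widehat{C_k}(x)=C_k(n-x)$.
   Context: $S_n$ is the symmetric group on $n$ letters. For $\nu\in S_n$ let $F(\nu)$ be its number of fixed points; the metric is $d_S(\sigma,\theta)=n-F(\sigma\theta^{ -1})$. For $j\in\{0,\dots,n\}$ let $v_j$ be the number of permutations with exactly $n-j$ fixed points. For nonempty $D\subseteq S_n$, its frequencies are $f_i=|\{(x,y)\in D^2: d_S(x,y)=i\}|/|D|^2$, $i=0,\dots,n$. $D$ is a $t$-design if $\sum_{j=0}^n f_j j^i=\sum_{j=0}^n \frac{v_j}{n!} j^i$ for every $i=1,\dots,t$. For $k\ge 0$, the Charlier polynomial is $C_k(x)=(-1)^k+\sum_{i=1}^k(-1)^{k-i}\binom{k}{i}x(x-1)\cdots(x-i+1)$. -}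

module Defs where

open import Data.Nat as ℕ using (ℕ; zero; suc; _∸_; _≤_; _!)
open import Data.Nat.Combinatorics using (_C_)
open import Data.Integer as ℤ using (ℤ; +_)
open import Data.Rational as ℚ using (ℚ; 0ℚ)
open import Data.Fin using (Fin)
open import Data.Fin.Properties using (_≟_)
open import Data.Vec as V using (Vec; []; _∷_; lookup; tabulate; toList)
open import Data.List as L using (List; []; _∷_; map; upTo; allFin; filter; length; concatMap; cartesianProduct)
import Data.List.Relation.Unary.Unique.DecPropositional as UDec
import Data.Product
open import Relation.Nullary using (¬_; does)
open import Data.Bool using (if_then_else_)
open import Data.List.Relation.Unary.Unique.Propositional using (Unique)
open import Relation.Binary.PropositionalEquality using (_≡_)
import Data.Nat.Properties as ℕP

-- A permutation of Fin n is represented by the vector of its values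
-- (i ↦ lookup σ i), which must be injective (no repeated entries).
Perm : ℕ → Set
Perm n = Vec (Fin n) n

allVecs : ∀ {n} (m : ℕ) → List (Vec (Fin n) m)
allVecs {n} zero = [] ∷ []
allVecs {n} (suc m) = concatMap (λ x → map (x ∷_) (allVecs m)) (allFin n)

Sn : (n : ℕ) → List (Perm n)
Sn n = filter (λ v → UDec.unique? (_≟_ {n}) (toList v)) (allVecs n)

IsPerm : ∀ {n} → Perm n → Set
IsPerm σ = Unique (toList σ)

private
  firstPre : ∀ {n} → Perm n → Fin n → List (Fin n) → Fin n
  firstPre θ i [] = i
  firstPre θ i (j ∷ js) = if does (lookup θ j ≟ i) then j else firstPre θ i js

inv : ∀ {n} → Perm n → Perm n
inv {n} θ = tabulate (λ i → firstPre θ i (allFin n))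

_∘ₚ_ : ∀ {n} → Perm n → Perm n → Perm n
σ ∘ₚ θ = tabulate (λ i → lookup σ (lookup θ i))

F : ∀ {n} → Perm n → ℕ
F {n} ν = length (filter (λ i → lookup ν i ≟ i) (allFin n))

dS : ∀ {n} → Perm n → Perm n → ℕ
dS {n} σ θ = n ∸ F (σ ∘ₚ inv θ)

v : (n j : ℕ) → ℕ
v n j = length (filter (λ σ → F σ ℕP.≟ (n ∸ j)) (Sn n))

_/ℕ_ : ℕ → ℕ → ℚ
a /ℕ zero = 0ℚ
a /ℕ suc b = (+ a) ℚ./ suc b

-- frequency f_i of a set D (given as a duplicate-free list)
freq : ∀ {n} → List (Perm n) → ℕ → ℚ
freq D i =
  length (filter (λ p → dS (Data.Product.proj₁ p) (Data.Product.proj₂ p) ℕP.≟ i) (cartesianProduct D D))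
  /ℕ (length D ℕ.* length D)

sumℚ : List ℚ → ℚ
sumℚ = L.foldr ℚ._+_ 0ℚ

sumℤ : List ℤ → ℤ
sumℤ = L.foldr ℤ._+_ (+ 0)

Σ[_⋯_] : ℕ → ℕ → (ℕ → ℚ) → ℚ
Σ[ lo ⋯ hi ] f = sumℚ (map (λ k → f (lo ℕ.+ k)) (upTo (suc hi ∸ lo)))

ℕtoℚ : ℕ → ℚ
ℕtoℚ a = (+ a) ℚ./ 1

ℤtoℚ : ℤ → ℚ
ℤtoℚ a = a ℚ./ 1

IsDesign : ∀ {n} → ℕ → List (Perm n) → Set
IsDesign {n} t D = ∀ i → 1 ≤ i → i ≤ t →
  Σ[ 0 ⋯ n ] (λ j → freq D j ℚ.* ℕtoℚ (j ℕ.^ i))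
  ≡ Σ[ 0 ⋯ n ] (λ j → (v n j /ℕ (n !)) ℚ.* ℕtoℚ (j ℕ.^ i))

falling : ℤ → ℕ → ℤ
falling x zero = + 1
falling x (suc i) = falling x i ℤ.* (x ℤ.- + i)

sgn : ℕ → ℤ
sgn zero = + 1
sgn (suc m) = ℤ.- sgn m

Charlier : ℕ → ℤ → ℤ
Charlier k x = sgn k ℤ.+ sumℤ (map (λ m → let i = suc m in
  sgn (k ∸ i) ℤ.* (+ (k C i)) ℤ.* falling x i) (upTo k))

Charlierhat : ℕ → ℕ → ℕ → ℤ
Charlierhat n k x = Charlier k (+ n ℤ.- + x)

{-# OPTIONS --safe #-}
module Submission where

-- Let f_j be the distance frequencies of D, u_j = v_j / n! those of the whole group, and
-- L h = Σ_{j ≤ n} (f_j - u_j) h(j).  Both weight systems sum to 1, so L kills constants and D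
-- is a t-design iff L kills j ↦ j^i for 1 ≤ i ≤ t.  Since Ĉ_k(j) = C_k(n - j) is ±j^k plus a
-- polynomial of lower degree, this is equivalent to L Ĉ_k = 0 for 1 ≤ k ≤ t.  The uniform part
-- of L Ĉ_k vanishes for k ≤ n: every factorial moment Σ_σ F(σ)(F(σ)-1)⋯(F(σ)-i+1) with i ≤ n
-- equals n!, so Σ_σ C_k(F σ) = n! Σ_i (-1)^(k-i) (k choose i) = n! (1 - 1)^k = 0.  Finally
-- Σ_{i ≥ 1} f_i (Ĉ_k(0) - Ĉ_k(i)) = Ĉ_k(0) - Σ_i f_i Ĉ_k(i) because Σ_i f_i = 1, so the
-- stated condition says exactly that L Ĉ_k = 0.

open import Algebra.Bundles using (CommutativeSemiring)

module ListSum {c ℓ} (R : CommutativeSemiring c ℓ) where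
  open import Level using (Level)
  open import Data.Bool using (true; false; if_then_else_)
  open import Data.Fin as Fin using (Fin; toℕ)
  open import Data.List using (List; []; _∷_; _++_; map; foldr; concatMap; filter; tabulate; applyUpTo)
  open import Data.Nat using (ℕ; zero; suc)
  open import Function using (_∘_)
  open import Relation.Nullary using (does)
  open import Relation.Unary using (Decidable)

  open CommutativeSemiring R
  open import Algebra.Properties.Semiring.Sum semiring public
  open import Algebra.Properties.CommutativeSemigroup +-commutativeSemigroup using (interchange)
  open import Relation.Binary.Reasoning.Setoid setoid

  private variable
    a : Level
    A B : Set a

  ∑ₗ : (A → Carrier) → List A → Carrier
  ∑ₗ f xs = foldr _+_ 0# (map f xs)

  ∑ₗ-cong : ∀ {f g : A → Carrier} → (∀ x → f x ≈ g x) → ∀ xs → ∑ₗ f xs ≈ ∑ₗ g xs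
  ∑ₗ-cong f≈g [] = refl
  ∑ₗ-cong f≈g (x ∷ xs) = +-cong (f≈g x) (∑ₗ-cong f≈g xs)

  ∑ₗ-zero : (xs : List A) → ∑ₗ (λ _ → 0#) xs ≈ 0#
  ∑ₗ-zero [] = refl
  ∑ₗ-zero (x ∷ xs) = trans (+-identityˡ _) (∑ₗ-zero xs)

  ∑ₗ-distrib-+ : ∀ (f g : A → Carrier) xs → ∑ₗ (λ x → f x + g x) xs ≈ ∑ₗ f xs + ∑ₗ g xs
  ∑ₗ-distrib-+ f g [] = sym (+-identityˡ 0#)
  ∑ₗ-distrib-+ f g (x ∷ xs) = begin
    f x + g x + ∑ₗ (λ x → f x + g x) xs   ≈⟨ +-congˡ (∑ₗ-distrib-+ f g xs) ⟩
    f x + g x + (∑ₗ f xs + ∑ₗ g xs)       ≈⟨ interchange (f x) (g x) _ _ ⟩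
    f x + ∑ₗ f xs + (g x + ∑ₗ g xs)       ∎

  *-distribˡ-∑ₗ : ∀ k (f : A → Carrier) xs → k * ∑ₗ f xs ≈ ∑ₗ (λ x → k * f x) xs
  *-distribˡ-∑ₗ k f [] = zeroʳ k
  *-distribˡ-∑ₗ k f (x ∷ xs) = trans (distribˡ k (f x) _) (+-congˡ (*-distribˡ-∑ₗ k f xs))

  *-distribʳ-∑ₗ : ∀ k (f : A → Carrier) xs → ∑ₗ f xs * k ≈ ∑ₗ (λ x → f x * k) xs
  *-distribʳ-∑ₗ k f xs = trans (*-comm _ k) (trans (*-distribˡ-∑ₗ k f xs) (∑ₗ-cong (λ x → *-comm k (f x)) xs))

  ∑ₗ-++ : ∀ (f : A → Carrier) xs ys → ∑ₗ f (xs ++ ys) ≈ ∑ₗ f xs + ∑ₗ f ys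
  ∑ₗ-++ f [] ys = sym (+-identityˡ _)
  ∑ₗ-++ f (x ∷ xs) ys = trans (+-congˡ (∑ₗ-++ f xs ys)) (sym (+-assoc (f x) _ _))

  ∑ₗ-map : ∀ (f : B → Carrier) (g : A → B) xs → ∑ₗ f (map g xs) ≈ ∑ₗ (f ∘ g) xs
  ∑ₗ-map f g [] = refl
  ∑ₗ-map f g (x ∷ xs) = +-congˡ (∑ₗ-map f g xs)

  ∑ₗ-concatMap : ∀ (f : B → Carrier) (g : A → List B) xs →
                 ∑ₗ f (concatMap g xs) ≈ ∑ₗ (λ x → ∑ₗ f (g x)) xs
  ∑ₗ-concatMap f g [] = refl
  ∑ₗ-concatMap f g (x ∷ xs) = trans (∑ₗ-++ f (g x) (concatMap g xs)) (+-congˡ (∑ₗ-concatMap f g xs))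

  ∑ₗ-filter : ∀ {p} {P : A → Set p} (P? : Decidable P) (f : A → Carrier) xs →
              ∑ₗ f (filter P? xs) ≈ ∑ₗ (λ x → if does (P? x) then f x else 0#) xs
  ∑ₗ-filter P? f [] = refl
  ∑ₗ-filter P? f (x ∷ xs) with does (P? x)
  ... | true  = +-congˡ (∑ₗ-filter P? f xs)
  ... | false = trans (∑ₗ-filter P? f xs) (sym (+-identityˡ _))

  ∑ₗ-tabulate : ∀ {n} (f : A → Carrier) (g : Fin n → A) → ∑ₗ f (tabulate g) ≈ ∑[ i < n ] f (g i)
  ∑ₗ-tabulate {n = zero} f g = refl
  ∑ₗ-tabulate {n = suc n} f g = +-congˡ (∑ₗ-tabulate f (g ∘ Fin.suc))

  ∑ₗ-applyUpTo : ∀ (f : A → Carrier) (g : ℕ → A) n → ∑ₗ f (applyUpTo g n) ≈ ∑[ i < n ] f (g (toℕ i))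
  ∑ₗ-applyUpTo f g zero = refl
  ∑ₗ-applyUpTo f g (suc n) = +-congˡ (∑ₗ-applyUpTo f (g ∘ suc) n)

  ∑ₗ-∑-comm : ∀ {n} (f : A → Fin n → Carrier) xs →
              ∑ₗ (λ x → ∑[ i < n ] f x i) xs ≈ ∑[ i < n ] ∑ₗ (λ x → f x i) xs
  ∑ₗ-∑-comm {n = n} f [] = sym (sum-replicate-zero n)
  ∑ₗ-∑-comm f (x ∷ xs) = trans (+-congˡ (∑ₗ-∑-comm f xs)) (sym (∑-distrib-+ (f x) _))


module FactorialMoments where

  open import Defs
  open import Data.Bool using (Bool; true; false; if_then_else_; not)
  open import Data.Fin as Fin using (Fin; toℕ)
  open import Data.Fin.Properties using (toℕ-injective) renaming (_≟_ to _≟ᶠ_)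
  open import Data.List using (List; []; _∷_; length; map; filter; allFin)
  open import Data.List.Relation.Unary.All using (All; []; _∷_)
  import Data.List.Relation.Unary.All as All
  open import Data.List.Relation.Unary.AllPairs using ([]; _∷_)
  open import Data.List.Relation.Unary.Any using (here; there)
  open import Data.List.Relation.Unary.Unique.Propositional using (Unique)
  import Data.List.Relation.Unary.Unique.DecPropositional as UniqueDec
  open import Data.Nat as ℕ using (ℕ; zero; suc; pred; _+_; _*_; _∸_; _≤_; _!; z≤n; s≤s; _≡ᵇ_; _<ᵇ_)
  open import Data.Nat.Properties
  open import Data.Nat.Tactic.RingSolver using (solve-∀)
  open import Data.Product using (_×_; _,_; proj₁; proj₂; uncurry)
  open import Data.Sum using (inj₁; inj₂)
  open import Data.Empty using (⊥-elim)
  open import Data.Vec using (Vec; []; _∷_; toList; lookup)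
  open import Function using (_∘_; mk⇔)
  open import Relation.Binary.PropositionalEquality
  open import Relation.Nullary using (Dec; yes; does; ¬_; _×-dec_; map′)
  open import Relation.Nullary.Decidable using (does-⇔)
  open import Relation.Unary using (Decidable)

  open ListSum +-*-commutativeSemiring

  𝟙 : Bool → ℕ
  𝟙 true = 1
  𝟙 false = 0

  length-filter-∑ₗ : ∀ {a p} {A : Set a} {P : A → Set p} (P? : Decidable P) xs →
                     length (filter P? xs) ≡ ∑ₗ (𝟙 ∘ does ∘ P?) xs
  length-filter-∑ₗ P? [] = refl
  length-filter-∑ₗ P? (x ∷ xs) with does (P? x)
  ... | true  = cong suc (length-filter-∑ₗ P? xs)
  ... | false = length-filter-∑ₗ P? xs

  fallingℕ : ℕ → ℕ → ℕ
  fallingℕ x zero = 1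
  fallingℕ zero (suc i) = 0
  fallingℕ (suc x) (suc i) = suc x * fallingℕ x i

  fallingℕ-suc : ∀ x i → fallingℕ (suc x) (suc i) ≡ fallingℕ x (suc i) + suc i * fallingℕ x i
  fallingℕ-suc zero zero = refl
  fallingℕ-suc zero (suc i) = sym (*-zeroʳ (suc (suc i)))
  fallingℕ-suc (suc x) zero = lemma x
    where
    lemma : ∀ x → suc (suc x) * 1 ≡ suc x * 1 + 1 * 1
    lemma = solve-∀
  fallingℕ-suc (suc x) (suc i) =
    trans (cong (λ z → suc x * fallingℕ x i + suc x * z) (fallingℕ-suc x i))
          (lemma x i (fallingℕ x (suc i)) (fallingℕ x i))
    where
    lemma : ∀ x i y b → suc x * b + suc x * (y + suc i * b) ≡ suc x * y + suc (suc i) * (suc x * b)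
    lemma = solve-∀

  -- arrangements p q i counts the pairs (π, τ) where π is a bijection from p + q slots onto
  -- p + q values in which p slots have their own value available, and τ is an ordered i-tuple
  -- of distinct slots that π sends to their own value; thus it is p(p-1)⋯(p-i+1)·(p+q-i)!.
  arrangements : ℕ → ℕ → ℕ → ℕ
  arrangements p q zero = (p + q) !
  arrangements zero q (suc i) = 0
  arrangements (suc p) q (suc i) = suc p * arrangements p q i

  arrangements-suc : ∀ p q i → arrangements p q (suc i) ≡ p * arrangements (pred p) q i
  arrangements-suc zero q i = refl
  arrangements-suc (suc p) q i = refl

  arrangements-unmatched : ∀ p q i →
    p * arrangements (pred p) (suc q) i + suc q * arrangements p q i ≡ arrangements p (suc q) i
  arrangements-unmatched zero q zero = refl
  arrangements-unmatched (suc p) q zero =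
    trans (cong (λ z → suc p * (p + suc q) ! + suc q * z) (cong _! (sym (+-suc p q))))
          (sym (*-distribʳ-+ ((p + suc q) !) (suc p) (suc q)))
  arrangements-unmatched zero q (suc i) = *-zeroʳ (suc q)
  arrangements-unmatched (suc p) q (suc i) = begin
    suc p * arrangements p (suc q) (suc i) + suc q * (suc p * A)
      ≡⟨ cong (λ z → suc p * z + suc q * (suc p * A)) (arrangements-suc p (suc q) i) ⟩
    suc p * (p * B) + suc q * (suc p * A)
      ≡⟨ lemma (suc p) p B (suc q) A ⟩
    suc p * (p * B + suc q * A)
      ≡⟨ cong (suc p *_) (arrangements-unmatched p q i) ⟩
    suc p * arrangements p (suc q) i ∎
    where
    open ≡-Reasoning
    A = arrangements p q i
    B = arrangements (pred p) (suc q) i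
    lemma : ∀ a b c d e → a * (b * c) + d * (a * e) ≡ a * (b * c + d * e)
    lemma = solve-∀

  arrangements-matched : ∀ p q i →
    arrangements p q i + i * arrangements p q (pred i) + p * arrangements (pred p) (suc q) i
      + q * arrangements p q i ≡ arrangements (suc p) q i
  arrangements-matched zero q zero = lemma q (q !)
    where
    lemma : ∀ q f → f + 0 + 0 + q * f ≡ f + q * f
    lemma = solve-∀
  arrangements-matched (suc p) q zero =
    trans (cong (λ z → suc (p + q) ! + 0 + suc p * z + q * suc (p + q) !) (cong _! (+-suc p q)))
          (lemma (suc p) q (suc (p + q) !))
    where
    lemma : ∀ p q f → f + 0 + p * f + q * f ≡ f + (p + q) * f
    lemma = solve-∀
  arrangements-matched zero q (suc zero) = lemma q (q !)
    where
    lemma : ∀ q f → 0 + 1 * f + 0 + q * 0 ≡ 1 * f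
    lemma = solve-∀
  arrangements-matched zero q (suc (suc j)) = lemma j q
    where
    lemma : ∀ j q → 0 + suc (suc j) * 0 + 0 + q * 0 ≡ 0
    lemma = solve-∀
  arrangements-matched (suc p) q (suc j) = +-cancelʳ-≡ (j * W) _ _ (begin
    P * X + suc j * W + P * arrangements p (suc q) (suc j) + q * (P * X) + j * W
      ≡⟨ cong (λ z → P * X + suc j * W + P * z + q * (P * X) + j * W) (arrangements-suc p (suc q) j) ⟩
    P * X + suc j * W + P * (p * Z) + q * (P * X) + j * W
      ≡⟨ cong (P * X + suc j * W + P * (p * Z) + q * (P * X) +_) (shift j) ⟩
    P * X + suc j * W + P * (p * Z) + q * (P * X) + P * Y
      ≡⟨ lemma P X j W p Z q Y ⟩
    P * (X + Y + p * Z + q * X) + suc j * W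
      ≡⟨ cong (λ z → P * z + suc j * W) (arrangements-matched p q j) ⟩
    P * W + suc j * W
      ≡⟨ +-suc-* P j W ⟩
    suc P * W + j * W ∎)
    where
    open ≡-Reasoning
    P = suc p
    X = arrangements p q j
    Y = j * arrangements p q (pred j)
    Z = arrangements (pred p) (suc q) j
    W = arrangements P q j
    shift : ∀ j → j * arrangements P q j ≡ P * (j * arrangements p q (pred j))
    shift zero = sym (*-zeroʳ P)
    shift (suc j) = lemma′ (suc j) P (arrangements p q j)
      where
      lemma′ : ∀ a b c → a * (b * c) ≡ b * (a * c)
      lemma′ = solve-∀
    +-suc-* : ∀ a b c → a * c + suc b * c ≡ suc a * c + b * c
    +-suc-* = solve-∀
    lemma : ∀ P X j W p Z q Y → P * X + suc j * W + P * (p * Z) + q * (P * X) + P * Y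
                                ≡ P * (X + Y + p * Z + q * X) + suc j * W
    lemma = solve-∀

  arrangements-top : ∀ p i → i ≤ p → arrangements p 0 i ≡ p !
  arrangements-top p zero _ = cong _! (+-identityʳ p)
  arrangements-top (suc p) (suc i) (s≤s i≤p) = cong (suc p *_) (arrangements-top p i i≤p)

  ∑-one : ∀ n → ∑[ i < n ] 1 ≡ n
  ∑-one zero = refl
  ∑-one (suc n) = cong suc (∑-one n)

  ∑-mono-≤ : ∀ {n} {f g : Fin n → ℕ} → (∀ i → f i ≤ g i) → sum f ≤ sum g
  ∑-mono-≤ {zero} f≤g = z≤n
  ∑-mono-≤ {suc n} f≤g = +-mono-≤ (f≤g Fin.zero) (∑-mono-≤ (f≤g ∘ Fin.suc))

  ∑-remove : ∀ {n} (f : Fin n → ℕ) x → sum f ≡ ∑[ y < n ] (𝟙 (not (does (y ≟ᶠ x))) * f y) + f x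
  ∑-remove {suc n} f Fin.zero =
    trans (+-comm (f Fin.zero) _) (cong (_+ f Fin.zero) (sum-cong-≗ (λ y → sym (+-identityʳ (f (Fin.suc y))))))
  ∑-remove {suc n} f (Fin.suc x) =
    trans (cong (f Fin.zero +_) (∑-remove (f ∘ Fin.suc) x)) (lemma (f Fin.zero) _ (f (Fin.suc x)))
    where
    lemma : ∀ a b c → a + (b + c) ≡ a + 0 + b + c
    lemma = solve-∀

  ∑-≡ᵇ≤1 : ∀ n o → ∑[ y < n ] 𝟙 (toℕ y ≡ᵇ o) ≤ 1
  ∑-≡ᵇ≤1 zero o = z≤n
  ∑-≡ᵇ≤1 (suc n) zero = s≤s (≤-reflexive (sum-replicate-zero n))
  ∑-≡ᵇ≤1 (suc n) (suc o) = ∑-≡ᵇ≤1 n o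

  ∑-<ᵇ : ∀ n o → ∑[ y < n ] 𝟙 (o <ᵇ toℕ y) ≡ n ∸ suc o
  ∑-<ᵇ zero o = refl
  ∑-<ᵇ (suc n) zero = ∑-one n
  ∑-<ᵇ (suc n) (suc o) = ∑-<ᵇ n o

  𝟙-trichotomy : ∀ o t → 𝟙 (t <ᵇ o) + 𝟙 (t ≡ᵇ o) + 𝟙 (o <ᵇ t) ≡ 1
  𝟙-trichotomy zero zero = refl
  𝟙-trichotomy zero (suc t) = refl
  𝟙-trichotomy (suc o) zero = refl
  𝟙-trichotomy (suc o) (suc t) = 𝟙-trichotomy o t

  𝟙-<ᵇ-suc : ∀ o t → 𝟙 (t <ᵇ suc o) ≡ 𝟙 (t <ᵇ o) + 𝟙 (t ≡ᵇ o)
  𝟙-<ᵇ-suc zero zero = refl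
  𝟙-<ᵇ-suc (suc o) zero = refl
  𝟙-<ᵇ-suc zero (suc t) = refl
  𝟙-<ᵇ-suc (suc o) (suc t) = 𝟙-<ᵇ-suc o t

  𝟙-<ᵇ-split : ∀ o t → 𝟙 (o <ᵇ t) ≡ 𝟙 (t ≡ᵇ suc o) + 𝟙 (suc o <ᵇ t)
  𝟙-<ᵇ-split zero zero = refl
  𝟙-<ᵇ-split zero (suc zero) = refl
  𝟙-<ᵇ-split zero (suc (suc t)) = refl
  𝟙-<ᵇ-split (suc o) zero = refl
  𝟙-<ᵇ-split (suc o) (suc t) = 𝟙-<ᵇ-split o t

  arrangements-first : ∀ A P Q m i → A ≤ 1 → P ≤ m → A + P + Q ≡ suc m →
    Q * arrangements P (pred (Q + A)) i
      + A * (arrangements P (pred (Q + A)) i + i * arrangements P (pred (Q + A)) (pred i))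
      + P * arrangements (pred P) (Q + A) i
    ≡ arrangements (A + P) Q i
  arrangements-first A P Q m i A≤1 P≤m total with n≤1⇒n≡0∨n≡1 A≤1
  arrangements-first .0 P zero m i A≤1 P≤m total | inj₁ refl =
    ⊥-elim (1+n≰n (≤-trans (≤-reflexive (trans (sym total) (+-identityʳ P))) P≤m))
  arrangements-first .0 P (suc q) m i A≤1 P≤m total | inj₁ refl rewrite +-identityʳ q =
    trans (lemma (suc q * arrangements P q i) (P * arrangements (pred P) (suc q) i)) (arrangements-unmatched P q i)
    where
    lemma : ∀ a b → a + 0 + b ≡ b + a
    lemma = solve-∀
  arrangements-first .1 P Q m i A≤1 P≤m total | inj₂ refl rewrite +-comm Q 1 =
    trans (lemma Q (arrangements P Q i) (i * arrangements P Q (pred i)) (P * arrangements (pred P) (suc Q) i))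
          (arrangements-matched P Q i)
    where
    lemma : ∀ q x y z → q * x + 1 * (x + y) + z ≡ x + y + z + q * x
    lemma = solve-∀

  free-total-step : ∀ p′ q′ l e g P Q A m → l + e + g ≡ 1 → p′ + g ≡ P → q′ + (l + e) ≡ Q + A →
                    A + P + Q ≡ suc m → p′ + q′ ≡ m
  free-total-step p′ q′ l e g P Q A m leg≡1 p′+g≡P q′+le≡Q+A total = suc-injective (begin
    suc (p′ + q′)                  ≡⟨ lemma₁ p′ q′ ⟩
    p′ + q′ + 1                    ≡⟨ cong (p′ + q′ +_) (sym leg≡1) ⟩
    p′ + q′ + (l + e + g)          ≡⟨ lemma₂ p′ q′ l e g ⟩
    (p′ + g) + (q′ + (l + e))      ≡⟨ cong₂ _+_ p′+g≡P q′+le≡Q+A ⟩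
    P + (Q + A)                    ≡⟨ lemma₃ P Q A ⟩
    A + P + Q                      ≡⟨ total ⟩
    suc m ∎)
    where
    open ≡-Reasoning
    lemma₁ : ∀ a b → suc (a + b) ≡ a + b + 1
    lemma₁ = solve-∀
    lemma₂ : ∀ p′ q′ l e g → p′ + q′ + (l + e + g) ≡ (p′ + g) + (q′ + (l + e))
    lemma₂ = solve-∀
    lemma₃ : ∀ P Q A → P + (Q + A) ≡ A + P + Q
    lemma₃ = solve-∀

  module _ {n : ℕ} where

    open import Data.List.Membership.DecPropositional (_≟ᶠ_ {n}) using (_∈_; _∉_; _∈?_; _∉?_)

    data Fresh (S : List (Fin n)) : ∀ {m} → Vec (Fin n) m → Set where
      [] : Fresh S []
      _∷_ : ∀ {m x} {w : Vec (Fin n) m} → x ∉ S → Fresh (x ∷ S) w → Fresh S (x ∷ w)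

    fresh? : ∀ S {m} (w : Vec (Fin n) m) → Dec (Fresh S w)
    fresh? S [] = yes []
    fresh? S (x ∷ w) = map′ (uncurry _∷_) uncons (x ∉? S ×-dec fresh? (x ∷ S) w)
      where
      uncons : Fresh S (x ∷ w) → x ∉ S × Fresh (x ∷ S) w
      uncons (x∉S ∷ fresh) = x∉S , fresh

    Fresh⇒Unique : ∀ {S m} {w : Vec (Fin n) m} → Fresh S w → Unique (toList w) × All (_∉ S) (toList w)
    Fresh⇒Unique [] = [] , []
    Fresh⇒Unique (x∉S ∷ fresh) =
      All.map (λ y∉x∷S x≡y → y∉x∷S (here (sym x≡y))) disjoint ∷ unique ,
      x∉S ∷ All.map (λ y∉x∷S y∈S → y∉x∷S (there y∈S)) disjoint
      where
      unique = proj₁ (Fresh⇒Unique fresh)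
      disjoint = proj₂ (Fresh⇒Unique fresh)

    Unique⇒Fresh : ∀ {S m} (w : Vec (Fin n) m) → Unique (toList w) → All (_∉ S) (toList w) → Fresh S w
    Unique⇒Fresh [] [] [] = []
    Unique⇒Fresh (x ∷ w) (x≢w ∷ unique) (x∉S ∷ disjoint) =
      x∉S ∷ Unique⇒Fresh w unique (All.zipWith (uncurry ∉-∷) (x≢w , disjoint))
      where
      ∉-∷ : ∀ {S y} → ¬ x ≡ y → y ∉ S → y ∉ x ∷ S
      ∉-∷ x≢y y∉S (here y≡x) = x≢y (sym y≡x)
      ∉-∷ x≢y y∉S (there y∈S) = y∉S y∈S

    does-fresh?≡does-unique? : (σ : Perm n) → does (fresh? [] σ) ≡ does (UniqueDec.unique? _≟ᶠ_ (toList σ))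
    does-fresh?≡does-unique? σ = does-⇔ (mk⇔ (proj₁ ∘ Fresh⇒Unique) (λ u → Unique⇒Fresh σ u (All.tabulate λ _ ())))
      (fresh? [] σ) (UniqueDec.unique? _≟ᶠ_ (toList σ))

    fixedFrom : ∀ {m} → ℕ → Vec (Fin n) m → ℕ
    fixedFrom o [] = 0
    fixedFrom o (x ∷ w) = 𝟙 (toℕ x ≡ᵇ o) + fixedFrom (suc o) w

    -- A partial permutation has used the values S at positions 0, …, o - 1; completionSum sums g
    -- over the fixed-point counts of its completions by the remaining m positions.
    completionSum : List (Fin n) → ℕ → (m : ℕ) → (ℕ → ℕ) → ℕ
    completionSum S o m g = ∑ₗ (λ w → if does (fresh? S w) then g (fixedFrom o w) else 0) (allVecs m)

    completionSum-suc : ∀ S o m g → completionSum S o (suc m) g ≡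
      ∑ₗ (λ x → if does (x ∈? S) then 0 else completionSum (x ∷ S) (suc o) m (g ∘ (𝟙 (toℕ x ≡ᵇ o) +_))) (allFin n)
    completionSum-suc S o m g =
      trans (∑ₗ-concatMap _ (λ x → map (x ∷_) (allVecs m)) (allFin n))
            (∑ₗ-cong (λ x → trans (∑ₗ-map _ (x ∷_) (allVecs m)) (first x)) (allFin n))
      where
      first : ∀ x → ∑ₗ (λ w → if does (fresh? S (x ∷ w)) then g (fixedFrom o (x ∷ w)) else 0) (allVecs m)
                  ≡ (if does (x ∈? S) then 0 else completionSum (x ∷ S) (suc o) m (g ∘ (𝟙 (toℕ x ≡ᵇ o) +_)))
      first x with does (x ∈? S)
      ... | true  = ∑ₗ-zero (allVecs m)
      ... | false = refl

    module _ (S : List (Fin n)) (o m : ℕ) where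

      completionSum-cong : ∀ {g h : ℕ → ℕ} → (∀ f → g f ≡ h f) → completionSum S o m g ≡ completionSum S o m h
      completionSum-cong {g} {h} g≗h = ∑ₗ-cong (λ w → pointwise (does (fresh? S w)) w) (allVecs m)
        where
        pointwise : ∀ b w → (if b then g (fixedFrom o w) else 0) ≡ (if b then h (fixedFrom o w) else 0)
        pointwise true  w = g≗h (fixedFrom o w)
        pointwise false w = refl

      completionSum-+ : ∀ g h → completionSum S o m (λ f → g f + h f) ≡ completionSum S o m g + completionSum S o m h
      completionSum-+ g h = trans (∑ₗ-cong (λ w → pointwise (does (fresh? S w)) w) (allVecs m)) (∑ₗ-distrib-+ _ _ (allVecs m))
        where
        pointwise : ∀ b w → (if b then g (fixedFrom o w) + h (fixedFrom o w) else 0)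
                            ≡ (if b then g (fixedFrom o w) else 0) + (if b then h (fixedFrom o w) else 0)
        pointwise true  w = refl
        pointwise false w = refl

      completionSum-* : ∀ c g → completionSum S o m (λ f → c * g f) ≡ c * completionSum S o m g
      completionSum-* c g = trans (∑ₗ-cong (λ w → pointwise (does (fresh? S w)) w) (allVecs m)) (sym (*-distribˡ-∑ₗ c _ (allVecs m)))
        where
        pointwise : ∀ b w → (if b then c * g (fixedFrom o w) else 0) ≡ c * (if b then g (fixedFrom o w) else 0)
        pointwise true  w = refl
        pointwise false w = sym (*-zeroʳ c)

    available : List (Fin n) → Fin n → ℕ
    available S y = 𝟙 (not (does (y ∈? S)))

    freeBelow freeAt freeAbove : List (Fin n) → ℕ → ℕ
    freeBelow S o = ∑[ y < n ] (available S y * 𝟙 (toℕ y <ᵇ o))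
    freeAt    S o = ∑[ y < n ] (available S y * 𝟙 (toℕ y ≡ᵇ o))
    freeAbove S o = ∑[ y < n ] (available S y * 𝟙 (o <ᵇ toℕ y))

    available-∷ : ∀ S x y → available (x ∷ S) y ≡ 𝟙 (not (does (y ≟ᶠ x))) * available S y
    available-∷ S x y with does (y ≟ᶠ x)
    ... | true  = refl
    ... | false = sym (+-identityʳ _)

    available-*-≤ : ∀ S y e → available S y * e ≤ e
    available-*-≤ S y e with does (y ∈? S)
    ... | true  = z≤n
    ... | false = ≤-reflexive (+-identityʳ e)

    freeAt≤1 : ∀ S o → freeAt S o ≤ 1
    freeAt≤1 S o = ≤-trans (∑-mono-≤ (λ y → available-*-≤ S y _)) (∑-≡ᵇ≤1 n o)

    freeAbove≤ : ∀ S o → freeAbove S o ≤ n ∸ suc o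
    freeAbove≤ S o = ≤-trans (∑-mono-≤ (λ y → available-*-≤ S y _)) (≤-reflexive (∑-<ᵇ n o))

    module _ (S : List (Fin n)) (o : ℕ) (x : Fin n) (x∉S : does (x ∈? S) ≡ false) where

      private
        available-x : ∀ e → available S x * e ≡ e
        available-x e rewrite x∉S = +-identityʳ e

        reassoc : ∀ a b c → a * (b * c) ≡ a * b * c
        reassoc a b c = sym (*-assoc a b c)

      freeAbove-step : freeAt (x ∷ S) (suc o) + freeAbove (x ∷ S) (suc o) + 𝟙 (o <ᵇ toℕ x) ≡ freeAbove S o
      freeAbove-step = begin
        freeAt (x ∷ S) (suc o) + freeAbove (x ∷ S) (suc o) + 𝟙 (o <ᵇ toℕ x)
          ≡⟨ cong (_+ 𝟙 (o <ᵇ toℕ x)) (sym (∑-distrib-+ {n} _ _)) ⟩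
        ∑[ y < n ] (available (x ∷ S) y * 𝟙 (toℕ y ≡ᵇ suc o) + available (x ∷ S) y * 𝟙 (suc o <ᵇ toℕ y))
          + 𝟙 (o <ᵇ toℕ x)
          ≡⟨ cong (_+ 𝟙 (o <ᵇ toℕ x)) (sum-cong-≗ λ y →
               trans (sym (*-distribˡ-+ (available (x ∷ S) y) _ _))
               (trans (cong₂ _*_ (available-∷ S x y) (sym (𝟙-<ᵇ-split o (toℕ y))))
                      (sym (reassoc (𝟙 (not (does (y ≟ᶠ x)))) (available S y) _)))) ⟩
        ∑[ y < n ] (𝟙 (not (does (y ≟ᶠ x))) * (available S y * 𝟙 (o <ᵇ toℕ y))) + 𝟙 (o <ᵇ toℕ x)
          ≡⟨ cong (∑[ y < n ] (𝟙 (not (does (y ≟ᶠ x))) * (available S y * 𝟙 (o <ᵇ toℕ y))) +_)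
               (sym (available-x _)) ⟩
        ∑[ y < n ] (𝟙 (not (does (y ≟ᶠ x))) * (available S y * 𝟙 (o <ᵇ toℕ y)))
          + available S x * 𝟙 (o <ᵇ toℕ x)
          ≡⟨ sym (∑-remove (λ y → available S y * 𝟙 (o <ᵇ toℕ y)) x) ⟩
        freeAbove S o ∎
        where open ≡-Reasoning

      freeBelow-step : freeBelow (x ∷ S) (suc o) + (𝟙 (toℕ x <ᵇ o) + 𝟙 (toℕ x ≡ᵇ o)) ≡ freeBelow S o + freeAt S o
      freeBelow-step = begin
        freeBelow (x ∷ S) (suc o) + 𝟙≤ x
          ≡⟨ cong (_+ 𝟙≤ x) (sum-cong-≗ λ y →
               trans (cong₂ _*_ (available-∷ S x y) (𝟙-<ᵇ-suc o (toℕ y)))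
                     (sym (reassoc (𝟙 (not (does (y ≟ᶠ x)))) (available S y) (𝟙≤ y)))) ⟩
        ∑[ y < n ] (𝟙 (not (does (y ≟ᶠ x))) * (available S y * 𝟙≤ y)) + 𝟙≤ x
          ≡⟨ cong (∑[ y < n ] (𝟙 (not (does (y ≟ᶠ x))) * (available S y * 𝟙≤ y)) +_) (sym (available-x _)) ⟩
        ∑[ y < n ] (𝟙 (not (does (y ≟ᶠ x))) * (available S y * 𝟙≤ y)) + available S x * 𝟙≤ x
          ≡⟨ sym (∑-remove (λ y → available S y * 𝟙≤ y) x) ⟩
        ∑[ y < n ] (available S y * 𝟙≤ y)
          ≡⟨ trans (sum-cong-≗ λ y → *-distribˡ-+ (available S y) _ _) (∑-distrib-+ {n} _ _) ⟩
        freeBelow S o + freeAt S o ∎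
        where
        open ≡-Reasoning
        𝟙≤ : Fin n → ℕ
        𝟙≤ y = 𝟙 (toℕ y <ᵇ o) + 𝟙 (toℕ y ≡ᵇ o)

    completionSum-fallingℕ-suc : ∀ S o m {p q} →
      (∀ i → completionSum S o m (λ f → fallingℕ f i) ≡ arrangements p q i) →
      ∀ i → completionSum S o m (λ f → fallingℕ (suc f) i) ≡ arrangements p q i + i * arrangements p q (pred i)
    completionSum-fallingℕ-suc S o m ih zero = trans (ih zero) (sym (+-identityʳ _))
    completionSum-fallingℕ-suc S o m {p} {q} ih (suc j) = begin
      completionSum S o m (λ f → fallingℕ (suc f) (suc j))
        ≡⟨ completionSum-cong S o m (λ f → fallingℕ-suc f j) ⟩
      completionSum S o m (λ f → fallingℕ f (suc j) + suc j * fallingℕ f j)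
        ≡⟨ completionSum-+ S o m (λ f → fallingℕ f (suc j)) (λ f → suc j * fallingℕ f j) ⟩
      completionSum S o m (λ f → fallingℕ f (suc j)) + completionSum S o m (λ f → suc j * fallingℕ f j)
        ≡⟨ cong₂ _+_ (ih (suc j)) (trans (completionSum-* S o m (suc j) (λ f → fallingℕ f j)) (cong (suc j *_) (ih j))) ⟩
      arrangements p q (suc j) + suc j * arrangements p q j ∎
      where open ≡-Reasoning

    module FirstPosition (S : List (Fin n)) (o m i : ℕ) where

      A = freeAt S o
      P = freeAbove S o
      Q = freeBelow S o
      viaBelow = arrangements P (pred (Q + A)) i
      viaFixed = arrangements P (pred (Q + A)) i + i * arrangements P (pred (Q + A)) (pred i)
      viaAbove = arrangements (pred P) (Q + A) i

      byClass : Fin n → ℕ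
      byClass x = 𝟙 (toℕ x <ᵇ o) * viaBelow + 𝟙 (toℕ x ≡ᵇ o) * viaFixed + 𝟙 (o <ᵇ toℕ x) * viaAbove

      ∑-byClass : ∑[ x < n ] (available S x * byClass x) ≡ Q * viaBelow + A * viaFixed + P * viaAbove
      ∑-byClass = begin
        ∑[ x < n ] (available S x * byClass x)
          ≡⟨ sum-cong-≗ (λ x → distrib (available S x) (𝟙 (toℕ x <ᵇ o)) (𝟙 (toℕ x ≡ᵇ o)) (𝟙 (o <ᵇ toℕ x))) ⟩
        ∑[ x < n ] (below x + fixed x + above x)
          ≡⟨ trans (∑-distrib-+ (λ x → below x + fixed x) above) (cong (_+ sum above) (∑-distrib-+ below fixed)) ⟩
        sum below + sum fixed + sum above
          ≡⟨ sym (cong₂ _+_ (cong₂ _+_ (*-distribʳ-sum viaBelow (λ x → available S x * 𝟙 (toℕ x <ᵇ o)))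
                                        (*-distribʳ-sum viaFixed (λ x → available S x * 𝟙 (toℕ x ≡ᵇ o))))
                           (*-distribʳ-sum viaAbove (λ x → available S x * 𝟙 (o <ᵇ toℕ x)))) ⟩
        Q * viaBelow + A * viaFixed + P * viaAbove ∎
        where
        open ≡-Reasoning
        below fixed above : Fin n → ℕ
        below x = available S x * 𝟙 (toℕ x <ᵇ o) * viaBelow
        fixed x = available S x * 𝟙 (toℕ x ≡ᵇ o) * viaFixed
        above x = available S x * 𝟙 (o <ᵇ toℕ x) * viaAbove
        distrib : ∀ s a b c → s * (a * viaBelow + b * viaFixed + c * viaAbove)
                              ≡ s * a * viaBelow + s * b * viaFixed + s * c * viaAbove
        distrib s a b c = lemma s a b c viaBelow viaFixed viaAbove
          where
          lemma : ∀ s a b c x y z → s * (a * x + b * y + c * z) ≡ s * a * x + s * b * y + s * c * z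
          lemma = solve-∀

      module _ (x : Fin n) where

        matchable′ unmatchable′ : ℕ
        matchable′ = freeAt (x ∷ S) (suc o) + freeAbove (x ∷ S) (suc o)
        unmatchable′ = freeBelow (x ∷ S) (suc o)

        placed : does (x ∈? S) ≡ false → A + P + Q ≡ suc m →
          (matchable′ + unmatchable′ ≡ m →
             ∀ j → completionSum (x ∷ S) (suc o) m (λ f → fallingℕ f j) ≡ arrangements matchable′ unmatchable′ j) →
          completionSum (x ∷ S) (suc o) m (λ f → fallingℕ (𝟙 (toℕ x ≡ᵇ o) + f) i) ≡ byClass x
        placed x∉S total ih =
          byCases (toℕ x <ᵇ o) (toℕ x ≡ᵇ o) (o <ᵇ toℕ x) (𝟙-trichotomy o (toℕ x))
                  (freeAbove-step S o x x∉S) (freeBelow-step S o x x∉S)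
          where
          p′ = matchable′
          q′ = unmatchable′
          ih′ : ∀ j → completionSum (x ∷ S) (suc o) m (λ f → fallingℕ f j) ≡ arrangements p′ q′ j
          ih′ = ih (free-total-step p′ q′ (𝟙 (toℕ x <ᵇ o)) (𝟙 (toℕ x ≡ᵇ o)) (𝟙 (o <ᵇ toℕ x)) P Q A m
                                    (𝟙-trichotomy o (toℕ x))
                                    (freeAbove-step S o x x∉S) (freeBelow-step S o x x∉S) total)
          pred-≡ : ∀ {a b} → a + 1 ≡ b → a ≡ pred b
          pred-≡ {a} eq = cong pred (trans (+-comm 1 a) eq)
          only₁ : ∀ a b c → a ≡ 1 * a + 0 * b + 0 * c
          only₁ = solve-∀
          only₂ : ∀ a b c → b ≡ 0 * a + 1 * b + 0 * c
          only₂ = solve-∀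
          only₃ : ∀ a b c → c ≡ 0 * a + 0 * b + 1 * c
          only₃ = solve-∀
          byCases : (below fixed above : Bool) → 𝟙 below + 𝟙 fixed + 𝟙 above ≡ 1 →
            p′ + 𝟙 above ≡ P → q′ + (𝟙 below + 𝟙 fixed) ≡ Q + A →
            completionSum (x ∷ S) (suc o) m (λ f → fallingℕ (𝟙 fixed + f) i)
              ≡ 𝟙 below * viaBelow + 𝟙 fixed * viaFixed + 𝟙 above * viaAbove
          byCases true false false _ p′≡ q′≡ =
            trans (ih′ i) (trans (cong₂ (λ a b → arrangements a b i) (trans (sym (+-identityʳ p′)) p′≡) (pred-≡ q′≡))
                                 (only₁ viaBelow viaFixed viaAbove))
          byCases false true false _ p′≡ q′≡ =
            trans (completionSum-fallingℕ-suc (x ∷ S) (suc o) m ih′ i)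
                  (trans (cong₂ (λ a b → arrangements a b i + i * arrangements a b (pred i))
                                (trans (sym (+-identityʳ p′)) p′≡) (pred-≡ q′≡))
                         (only₂ viaBelow viaFixed viaAbove))
          byCases false false true _ p′≡ q′≡ =
            trans (ih′ i) (trans (cong₂ (λ a b → arrangements a b i) (pred-≡ p′≡) (trans (sym (+-identityʳ q′)) q′≡))
                                 (only₃ viaBelow viaFixed viaAbove))
          byCases true true _ ()
          byCases true false true ()
          byCases false true true ()
          byCases false false false ()

    -- A free value y can still become a fixed point iff y ≥ o, since its own position is then
    -- still unfilled; so the state behaves like arrangements with freeAt + freeAbove matchable slots.
    completionSum-fallingℕ : ∀ m S o i → o + m ≡ n → freeAt S o + freeAbove S o + freeBelow S o ≡ m →
      completionSum S o m (λ f → fallingℕ f i) ≡ arrangements (freeAt S o + freeAbove S o) (freeBelow S o) i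
    completionSum-fallingℕ zero S o i o+m≡n total
      rewrite m+n≡0⇒m≡0 (freeAt S o + freeAbove S o) total | m+n≡0⇒n≡0 (freeAt S o + freeAbove S o) total
      = empty i
      where
      empty : ∀ i → fallingℕ 0 i + 0 ≡ arrangements 0 0 i
      empty zero    = refl
      empty (suc i) = refl
    completionSum-fallingℕ (suc m) S o i o+m≡n total = begin
      completionSum S o (suc m) (λ f → fallingℕ f i)
        ≡⟨ completionSum-suc S o m (λ f → fallingℕ f i) ⟩
      ∑ₗ placeAt (allFin n)
        ≡⟨ ∑ₗ-tabulate placeAt (λ x → x) ⟩
      ∑[ x < n ] placeAt x
        ≡⟨ sum-cong-≗ placeAt≡ ⟩
      ∑[ x < n ] (available S x * byClass x)
        ≡⟨ ∑-byClass ⟩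
      Q * viaBelow + A * viaFixed + P * viaAbove
        ≡⟨ arrangements-first A P Q m i (freeAt≤1 S o) P≤m total ⟩
      arrangements (A + P) Q i ∎
      where
      open ≡-Reasoning
      open FirstPosition S o m i

      placeAt : Fin n → ℕ
      placeAt x = if does (x ∈? S) then 0
                  else completionSum (x ∷ S) (suc o) m (λ f → fallingℕ (𝟙 (toℕ x ≡ᵇ o) + f) i)

      suc-o+m≡n : suc o + m ≡ n
      suc-o+m≡n = trans (sym (+-suc o m)) o+m≡n

      P≤m : P ≤ m
      P≤m = ≤-trans (freeAbove≤ S o) (≤-reflexive (trans (cong (_∸ suc o) (sym suc-o+m≡n)) (m+n∸m≡n (suc o) m)))

      placeAt≡ : ∀ x → placeAt x ≡ available S x * byClass x
      placeAt≡ x with does (x ∈? S) in x∉S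
      ... | true  = refl
      ... | false = trans (placed x x∉S total λ total′ j →
                                     completionSum-fallingℕ m (x ∷ S) (suc o) j suc-o+m≡n total′)
                          (sym (+-identityʳ _))

    fixedFrom≡∑ : ∀ {m} o (w : Vec (Fin n) m) → fixedFrom o w ≡ ∑[ k < m ] 𝟙 (toℕ (lookup w k) ≡ᵇ o + toℕ k)
    fixedFrom≡∑ o [] = refl
    fixedFrom≡∑ o (x ∷ w) =
      cong₂ _+_ (cong (λ z → 𝟙 (toℕ x ≡ᵇ z)) (sym (+-identityʳ o)))
                (trans (fixedFrom≡∑ (suc o) w)
                       (sum-cong-≗ λ k → cong (λ z → 𝟙 (toℕ (lookup w k) ≡ᵇ z)) (sym (+-suc o (toℕ k)))))

    F≡fixedFrom : (σ : Perm n) → F σ ≡ fixedFrom 0 σ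
    F≡fixedFrom σ = begin
      F σ
        ≡⟨ length-filter-∑ₗ (λ i → lookup σ i ≟ᶠ i) (allFin n) ⟩
      ∑ₗ (λ i → 𝟙 (does (lookup σ i ≟ᶠ i))) (allFin n)
        ≡⟨ ∑ₗ-tabulate (λ i → 𝟙 (does (lookup σ i ≟ᶠ i))) (λ i → i) ⟩
      ∑[ i < n ] 𝟙 (does (lookup σ i ≟ᶠ i))
        ≡⟨ sum-cong-≗ (λ i → cong 𝟙 (does-⇔ (mk⇔ (cong toℕ) toℕ-injective)
                                            (lookup σ i ≟ᶠ i) (toℕ (lookup σ i) ℕ.≟ toℕ i))) ⟩
      ∑[ i < n ] 𝟙 (toℕ (lookup σ i) ≡ᵇ toℕ i)
        ≡⟨ sym (fixedFrom≡∑ 0 σ) ⟩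
      fixedFrom 0 σ ∎
      where open ≡-Reasoning

  ∑-fallingℕ-fixedPoints : ∀ n i → i ≤ n → ∑ₗ (λ σ → fallingℕ (F σ) i) (Sn n) ≡ n !
  ∑-fallingℕ-fixedPoints n i i≤n = begin
    ∑ₗ (λ σ → fallingℕ (F σ) i) (Sn n)
      ≡⟨ ∑ₗ-filter (λ σ → UniqueDec.unique? _≟ᶠ_ (toList σ)) (λ σ → fallingℕ (F σ) i) (allVecs n) ⟩
    ∑ₗ (λ σ → if does (UniqueDec.unique? _≟ᶠ_ (toList σ)) then fallingℕ (F σ) i else 0) (allVecs n)
      ≡⟨ ∑ₗ-cong (λ σ → cong₂ (λ b f → if b then fallingℕ f i else 0)
                              (sym (does-fresh?≡does-unique? σ)) (F≡fixedFrom σ)) (allVecs n) ⟩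
    completionSum [] 0 n (λ f → fallingℕ f i)
      ≡⟨ completionSum-fallingℕ n [] 0 i refl (trans (cong (freeAt {n} [] 0 + freeAbove {n} [] 0 +_) below≡0)
                                                           (trans (+-identityʳ _) matchable≡n)) ⟩
    arrangements (freeAt {n} [] 0 + freeAbove {n} [] 0) (freeBelow {n} [] 0) i
      ≡⟨ cong₂ (λ p q → arrangements p q i) matchable≡n below≡0 ⟩
    arrangements n 0 i
      ≡⟨ arrangements-top n i i≤n ⟩
    n ! ∎
    where
    open ≡-Reasoning
    below≡0 : freeBelow {n} [] 0 ≡ 0
    below≡0 = sum-replicate-zero n
    matchable≡n : freeAt {n} [] 0 + freeAbove {n} [] 0 ≡ n
    matchable≡n =
      trans (sym (∑-distrib-+ (λ (y : Fin n) → 1 * 𝟙 (toℕ y ≡ᵇ 0)) (λ y → 1 * 𝟙 (0 <ᵇ toℕ y))))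
            (trans (sum-cong-≗ {n} (λ y → zeroOrAbove (toℕ y))) (∑-one n))
      where
      zeroOrAbove : ∀ t → 1 * 𝟙 (t ≡ᵇ 0) + 1 * 𝟙 (0 <ᵇ t) ≡ 1
      zeroOrAbove zero = refl
      zeroOrAbove (suc t) = refl

module CharlierMean where

  open FactorialMoments using (fallingℕ; ∑-fallingℕ-fixedPoints)
  open import Defs
  open import Data.Fin using (Fin; toℕ)
  open import Data.Fin.Properties using (toℕ<n)
  open import Data.Integer as ℤ using (ℤ; +_; 0ℤ; 1ℤ; -1ℤ; _+_; _*_; _-_)
  import Data.Integer.Properties as ℤP
  open import Data.List using ([]; _∷_)
  open import Data.Nat as ℕ using (ℕ; zero; suc; _∸_; _≤_; _<_; s≤s; _!)
  import Data.Nat.Properties as ℕP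
  open import Data.Nat.Combinatorics using (_C_)
  open import Relation.Binary.PropositionalEquality
  open import Relation.Nullary using (yes; no)
  import Algebra.Properties.CommutativeSemiring.Binomial ℤP.+-*-commutativeSemiring as Binomial
  open import Algebra.Properties.Semiring.Exp (ℤP.+-*-semiring) using (_^_)
  open import Algebra.Definitions.RawMonoid ℤ.+-0-rawMonoid using (_×_)

  open ListSum ℤP.+-*-commutativeSemiring
  private module ℕ∑ = ListSum ℕP.+-*-commutativeSemiring

  ∑ₗ-pos : ∀ {A : Set} (f : A → ℕ) xs → ∑ₗ (λ x → + f x) xs ≡ + ℕ∑.∑ₗ f xs
  ∑ₗ-pos f [] = refl
  ∑ₗ-pos f (x ∷ xs) = trans (cong (λ s → + f x + s) (∑ₗ-pos f xs)) (sym (ℤP.pos-+ (f x) _))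

  ×≡* : ∀ n z → n × z ≡ + n * z
  ×≡* zero z = refl
  ×≡* (suc n) z = trans (cong (λ s → z + s) (×≡* n z)) (sym (ℤP.suc-* (+ n) z))

  -1^≡sgn : ∀ m → -1ℤ ^ m ≡ sgn m
  -1^≡sgn zero = refl
  -1^≡sgn (suc m) = trans (cong (-1ℤ *_) (-1^≡sgn m)) (ℤP.-1*i≡-i (sgn m))

  1^≡1 : ∀ m → 1ℤ ^ m ≡ 1ℤ
  1^≡1 zero = refl
  1^≡1 (suc m) = trans (ℤP.*-identityˡ _) (1^≡1 m)

  charlierCoeff : ℕ → ℕ → ℤ
  charlierCoeff k i = sgn (k ∸ i) * + (k C i)

  ∑-charlierCoeff : ∀ k → ∑[ i < suc (suc k) ] charlierCoeff (suc k) (toℕ i) ≡ 0ℤ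
  ∑-charlierCoeff k = trans (sum-cong-≗ {suc (suc k)} term) (sym (Binomial.theorem (suc k) 1ℤ -1ℤ))
    where
    term : ∀ i → charlierCoeff (suc k) (toℕ i) ≡ Binomial.binomialTerm 1ℤ -1ℤ (suc k) i
    term i = sym (begin
      (suc k C toℕ i) × (1ℤ ^ toℕ i * -1ℤ ^ (suc k ∸ toℕ i))
        ≡⟨ ×≡* (suc k C toℕ i) _ ⟩
      + (suc k C toℕ i) * (1ℤ ^ toℕ i * -1ℤ ^ (suc k ∸ toℕ i))
        ≡⟨ cong₂ (λ a b → + (suc k C toℕ i) * (a * b)) (1^≡1 (toℕ i)) (-1^≡sgn (suc k ∸ toℕ i)) ⟩
      + (suc k C toℕ i) * (1ℤ * sgn (suc k ∸ toℕ i))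
        ≡⟨ cong (+ (suc k C toℕ i) *_) (ℤP.*-identityˡ _) ⟩
      + (suc k C toℕ i) * sgn (suc k ∸ toℕ i)
        ≡⟨ ℤP.*-comm (+ (suc k C toℕ i)) _ ⟩
      charlierCoeff (suc k) (toℕ i) ∎)
      where open ≡-Reasoning

  fallingℕ-snoc : ∀ x i → fallingℕ x (suc i) ≡ fallingℕ x i ℕ.* (x ∸ i)
  fallingℕ-snoc zero zero = refl
  fallingℕ-snoc zero (suc i) = refl
  fallingℕ-snoc (suc x) zero = trans (ℕP.*-identityʳ (suc x)) (sym (ℕP.*-identityˡ (suc x)))
  fallingℕ-snoc (suc x) (suc i) =
    trans (cong (suc x ℕ.*_) (fallingℕ-snoc x i)) (sym (ℕP.*-assoc (suc x) (fallingℕ x i) (x ∸ i)))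

  fallingℕ-vanishes : ∀ x i → x < i → fallingℕ x i ≡ 0
  fallingℕ-vanishes zero (suc i) _ = refl
  fallingℕ-vanishes (suc x) (suc i) (s≤s x<i) =
    trans (cong (suc x ℕ.*_) (fallingℕ-vanishes x i x<i)) (ℕP.*-zeroʳ (suc x))

  falling-pos : ∀ x i → falling (+ x) i ≡ + fallingℕ x i
  falling-pos x zero = refl
  falling-pos x (suc i) with i ℕP.≤? x
  ... | yes i≤x = begin
    falling (+ x) i * (+ x - + i)
      ≡⟨ cong₂ _*_ (falling-pos x i) (trans (ℤP.m-n≡m⊖n x i) (ℤP.⊖-≥ i≤x)) ⟩
    + fallingℕ x i * + (x ∸ i)
      ≡⟨ sym (ℤP.pos-* (fallingℕ x i) (x ∸ i)) ⟩
    + (fallingℕ x i ℕ.* (x ∸ i))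
      ≡⟨ cong +_ (sym (fallingℕ-snoc x i)) ⟩
    + fallingℕ x (suc i) ∎
    where open ≡-Reasoning
  ... | no i≰x = trans (cong (_* (+ x - + i)) (trans (falling-pos x i) (cong +_ (fallingℕ-vanishes x i x<i))))
                       (sym (cong +_ (fallingℕ-vanishes x (suc i) (ℕP.m<n⇒m<1+n x<i))))
    where
    x<i = ℕP.≰⇒> i≰x

  Charlier-∑ : ∀ k x → Charlier k x ≡ ∑[ i < suc k ] (charlierCoeff k (toℕ i) * falling x (toℕ i))
  Charlier-∑ k x = cong₂ _+_ (sym (trans (ℤP.*-identityʳ _) (ℤP.*-identityʳ (sgn k))))
                             (∑ₗ-applyUpTo (λ m → charlierCoeff k (suc m) * falling x (suc m)) (λ i → i) k)

  ∑-Charlier-fixedPoints : ∀ n k → 1 ≤ k → k ≤ n → ∑ₗ (λ σ → Charlier k (+ F σ)) (Sn n) ≡ 0ℤ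
  ∑-Charlier-fixedPoints n (suc k) _ k≤n = begin
    ∑ₗ (λ σ → Charlier (suc k) (+ F σ)) (Sn n)
      ≡⟨ ∑ₗ-cong (λ σ → Charlier-∑ (suc k) (+ F σ)) (Sn n) ⟩
    ∑ₗ (λ σ → ∑[ i < suc (suc k) ] (c i * falling (+ F σ) (toℕ i))) (Sn n)
      ≡⟨ ∑ₗ-∑-comm (λ σ i → c i * falling (+ F σ) (toℕ i)) (Sn n) ⟩
    ∑[ i < suc (suc k) ] ∑ₗ (λ σ → c i * falling (+ F σ) (toℕ i)) (Sn n)
      ≡⟨ sum-cong-≗ {suc (suc k)} moment ⟩
    ∑[ i < suc (suc k) ] (c i * + (n !))
      ≡⟨ sym (*-distribʳ-sum (+ (n !)) c) ⟩
    ∑[ i < suc (suc k) ] c i * + (n !)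
      ≡⟨ cong (_* + (n !)) (∑-charlierCoeff k) ⟩
    0ℤ ∎
    where
    open ≡-Reasoning
    c : Fin (suc (suc k)) → ℤ
    c i = charlierCoeff (suc k) (toℕ i)
    moment : ∀ i → ∑ₗ (λ σ → c i * falling (+ F σ) (toℕ i)) (Sn n) ≡ c i * + (n !)
    moment i = begin
      ∑ₗ (λ σ → c i * falling (+ F σ) (toℕ i)) (Sn n)
        ≡⟨ sym (*-distribˡ-∑ₗ (c i) (λ σ → falling (+ F σ) (toℕ i)) (Sn n)) ⟩
      c i * ∑ₗ (λ σ → falling (+ F σ) (toℕ i)) (Sn n)
        ≡⟨ cong (c i *_) (trans (∑ₗ-cong (λ σ → falling-pos (F σ) (toℕ i)) (Sn n))
                                (∑ₗ-pos (λ σ → fallingℕ (F σ) (toℕ i)) (Sn n))) ⟩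
      c i * + ℕ∑.∑ₗ (λ σ → fallingℕ (F σ) (toℕ i)) (Sn n)
        ≡⟨ cong (λ m → c i * + m) (∑-fallingℕ-fixedPoints n (toℕ i) (ℕP.≤-trans (ℕP.≤-pred (toℕ<n i)) k≤n)) ⟩
      c i * + (n !) ∎

module CharlierPolynomial where

  open CharlierMean using (charlierCoeff; Charlier-∑)
  open import Defs
  open import Data.Fin as Fin using (Fin; toℕ; fromℕ; inject₁)
  open import Data.Fin.Properties using (toℕ-fromℕ; toℕ-inject₁; toℕ<n)
  open import Data.Integer as ℤ using (ℤ; +_; 0ℤ; 1ℤ; _+_; _*_; _-_; -_; _^_)
  import Data.Integer.Properties as ℤP
  open import Data.Integer.Tactic.RingSolver using (solve-∀)
  open import Data.List using (List; []; _∷_; length)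
  open import Data.List.Properties using (length-map)
  open import Function using (_∘_)
  open import Data.Nat as ℕ using (ℕ; zero; suc; _∸_; _≤_; _<_; z≤n; s≤s)
  import Data.Nat.Properties as ℕP
  open import Data.Nat.Combinatorics using (_C_; nCn≡1)
  open import Data.Product using (Σ-syntax; _×_; _,_)
  open import Relation.Binary.PropositionalEquality

  open ListSum ℤP.+-*-commutativeSemiring using (sum-syntax; sum-init-last)

  eval : List ℤ → ℤ → ℤ
  eval [] x = 0ℤ
  eval (c ∷ cs) x = c + x * eval cs x

  Poly< : ℕ → (ℤ → ℤ) → Set
  Poly< k h = Σ[ cs ∈ List ℤ ] length cs ≤ k × (∀ x → h x ≡ eval cs x)

  private
    _⊕_ : List ℤ → List ℤ → List ℤ
    [] ⊕ q = q
    (a ∷ p) ⊕ [] = a ∷ p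
    (a ∷ p) ⊕ (b ∷ q) = (a + b) ∷ (p ⊕ q)

    eval-⊕ : ∀ p q x → eval (p ⊕ q) x ≡ eval p x + eval q x
    eval-⊕ [] q x = sym (ℤP.+-identityˡ _)
    eval-⊕ (a ∷ p) [] x = sym (ℤP.+-identityʳ _)
    eval-⊕ (a ∷ p) (b ∷ q) x = trans (cong (λ e → a + b + x * e) (eval-⊕ p q x)) (lemma a b x (eval p x) (eval q x))
      where
      lemma : ∀ a b x u v → a + b + x * (u + v) ≡ a + x * u + (b + x * v)
      lemma = solve-∀

    length-⊕ : ∀ {k} p q → length p ≤ k → length q ≤ k → length (p ⊕ q) ≤ k
    length-⊕ [] q _ q≤k = q≤k
    length-⊕ (a ∷ p) [] p≤k _ = p≤k
    length-⊕ (a ∷ p) (b ∷ q) (s≤s p≤k) (s≤s q≤k) = s≤s (length-⊕ p q p≤k q≤k)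

    scale : ℤ → List ℤ → List ℤ
    scale c = Data.List.map (c *_)

    eval-scale : ∀ c p x → eval (scale c p) x ≡ c * eval p x
    eval-scale c [] x = sym (ℤP.*-zeroʳ c)
    eval-scale c (a ∷ p) x = trans (cong (λ e → c * a + x * e) (eval-scale c p x)) (lemma c a x (eval p x))
      where
      lemma : ∀ c a x e → c * a + x * (c * e) ≡ c * (a + x * e)
      lemma = solve-∀

  module _ {k : ℕ} where

    Poly<-cong : ∀ {f g : ℤ → ℤ} → (∀ x → f x ≡ g x) → Poly< k f → Poly< k g
    Poly<-cong f≗g (cs , len , f≡) = cs , len , λ x → trans (sym (f≗g x)) (f≡ x)

    Poly<-zero : Poly< k (λ _ → 0ℤ)
    Poly<-zero = [] , z≤n , λ _ → refl

    Poly<-+ : ∀ {f g : ℤ → ℤ} → Poly< k f → Poly< k g → Poly< k (λ x → f x + g x)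
    Poly<-+ (p , p≤k , f≡) (q , q≤k , g≡) =
      p ⊕ q , length-⊕ p q p≤k q≤k , λ x → trans (cong₂ _+_ (f≡ x) (g≡ x)) (sym (eval-⊕ p q x))

    Poly<-* : ∀ c {f : ℤ → ℤ} → Poly< k f → Poly< k (λ x → c * f x)
    Poly<-* c (p , p≤k , f≡) =
      scale c p , ℕP.≤-trans (ℕP.≤-reflexive (length-map (c *_) p)) p≤k ,
      λ x → trans (cong (c *_) (f≡ x)) (sym (eval-scale c p x))

    Poly<-x* : ∀ {f : ℤ → ℤ} → Poly< k f → Poly< (suc k) (λ x → x * f x)
    Poly<-x* (p , p≤k , f≡) = 0ℤ ∷ p , s≤s p≤k , λ x → trans (cong (x *_) (f≡ x)) (sym (ℤP.+-identityˡ _))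

    Poly<-∑ : ∀ {m} {f : Fin m → ℤ → ℤ} → (∀ i → Poly< k (f i)) → Poly< k (λ x → ∑[ i < m ] f i x)
    Poly<-∑ {zero} _ = Poly<-zero
    Poly<-∑ {suc m} poly = Poly<-+ (poly Fin.zero) (Poly<-∑ (poly ∘ Fin.suc))

  Poly<-mono : ∀ {j k} {h : ℤ → ℤ} → j ≤ k → Poly< j h → Poly< k h
  Poly<-mono j≤k (p , p≤j , h≡) = p , ℕP.≤-trans p≤j j≤k , h≡

  Poly<-^ : ∀ i → Poly< (suc i) (_^ i)
  Poly<-^ zero = 1ℤ ∷ [] , s≤s z≤n , λ x → sym (trans (cong (λ e → 1ℤ + e) (ℤP.*-zeroʳ x)) (ℤP.+-identityʳ 1ℤ))
  Poly<-^ (suc i) = Poly<-x* (Poly<-^ i)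

  falling-leading : ∀ c i → Poly< i (λ x → falling (c - x) i - sgn i * x ^ i)
  falling-leading c zero = Poly<-zero
  falling-leading c (suc i) =
    Poly<-cong (λ x → lemma (falling (c - x) i) (sgn i) c x (+ i) (x ^ i))
      (Poly<-+ (Poly<-+ (Poly<-mono (ℕP.n≤1+n i) (Poly<-* (c - + i) ih)) (Poly<-* (- 1ℤ) (Poly<-x* ih)))
               (Poly<-* (sgn i * (c - + i)) (Poly<-^ i)))
    where
    ih = falling-leading c i
    lemma : ∀ F s c x i X → (c - i) * (F - s * X) + (- 1ℤ) * (x * (F - s * X)) + s * (c - i) * X
                            ≡ F * (c - x - i) - (- s) * (x * X)
    lemma = solve-∀

  falling-poly : ∀ c i → Poly< (suc i) (λ x → falling (c - x) i)
  falling-poly c i =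
    Poly<-cong (λ x → lemma (falling (c - x) i) (sgn i * x ^ i))
      (Poly<-+ (Poly<-mono (ℕP.n≤1+n i) (falling-leading c i)) (Poly<-* (sgn i) (Poly<-^ i)))
    where
    lemma : ∀ F S → F - S + S ≡ F
    lemma = solve-∀

  charlierCoeff-top : ∀ k → charlierCoeff k k ≡ 1ℤ
  charlierCoeff-top k = cong₂ (λ a b → sgn a * + b) (ℕP.n∸n≡0 k) (nCn≡1 k)

  Charlier-leading : ∀ c k → Poly< k (λ x → Charlier k (c - x) - sgn k * x ^ k)
  Charlier-leading c k =
    Poly<-cong split (Poly<-+ (Poly<-∑ lower) (falling-leading c k))
    where
    term : Fin (suc k) → ℤ → ℤ
    term i x = charlierCoeff k (toℕ i) * falling (c - x) (toℕ i)

    lower : ∀ i → Poly< k (term (inject₁ i))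
    lower i = Poly<-* (charlierCoeff k (toℕ (inject₁ i)))
                      (Poly<-mono (ℕP.≤-trans (s≤s (ℕP.≤-reflexive (toℕ-inject₁ i))) (toℕ<n i)) (falling-poly c _))

    top : ∀ x → term (fromℕ k) x ≡ falling (c - x) k
    top x rewrite toℕ-fromℕ k = trans (cong (_* falling (c - x) k) (charlierCoeff-top k)) (ℤP.*-identityˡ _)

    split : ∀ x → ∑[ i < k ] term (inject₁ i) x + (falling (c - x) k - sgn k * x ^ k) ≡ Charlier k (c - x) - sgn k * x ^ k
    split x = sym (begin
      Charlier k (c - x) - sgn k * x ^ k
        ≡⟨ cong (_- sgn k * x ^ k) (trans (Charlier-∑ k (c - x)) (sum-init-last (λ i → term i x))) ⟩
      ∑[ i < k ] term (inject₁ i) x + term (fromℕ k) x - sgn k * x ^ k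
        ≡⟨ cong (λ t → ∑[ i < k ] term (inject₁ i) x + t - sgn k * x ^ k) (top x) ⟩
      ∑[ i < k ] term (inject₁ i) x + falling (c - x) k - sgn k * x ^ k
        ≡⟨ ℤP.+-assoc (∑[ i < k ] term (inject₁ i) x) (falling (c - x) k) (- (sgn k * x ^ k)) ⟩
      ∑[ i < k ] term (inject₁ i) x + (falling (c - x) k - sgn k * x ^ k) ∎)
      where open ≡-Reasoning

module RationalSums where

  open FactorialMoments using (𝟙)
  open import Defs
  open import Algebra.Bundles using (CommutativeRing)
  open import Data.Fin as Fin using (Fin; toℕ)
  open import Data.Integer as ℤ using (ℤ; +_)
  import Data.Integer.Properties as ℤP
  open import Data.Integer.Tactic.RingSolver using (solve-∀)
  open import Data.List using ([]; _∷_)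
  open import Data.Nat as ℕ using (ℕ; zero; suc; _≤_; _<_; s≤s; _≡ᵇ_)
  import Data.Nat.Properties as ℕP
  open import Data.Rational as ℚ using (ℚ; 1ℚ; _+_; _*_; _-_; -_; toℚᵘ)
  import Data.Rational.Properties as ℚP
  open import Data.Rational.Unnormalised as ℚᵘ using (mkℚᵘ; *≡*)
  import Data.Rational.Unnormalised.Properties as ℚᵘP
  open import Relation.Binary.PropositionalEquality

  open ListSum (CommutativeRing.commutativeSemiring ℚP.+-*-commutativeRing)
  private
    module ℕ∑ = ListSum ℕP.+-*-commutativeSemiring
    module ℤ∑ = ListSum ℤP.+-*-commutativeSemiring

  ℤtoℚ-≃ : ∀ a → toℚᵘ (ℤtoℚ a) ℚᵘ.≃ mkℚᵘ a 0
  ℤtoℚ-≃ a = ℚP.toℚᵘ-fromℚᵘ (mkℚᵘ a 0)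

  ℤtoℚ-+ : ∀ a b → ℤtoℚ (a ℤ.+ b) ≡ ℤtoℚ a + ℤtoℚ b
  ℤtoℚ-+ a b = ℚP.toℚᵘ-injective (ℚᵘP.≃-trans (ℤtoℚ-≃ (a ℤ.+ b))
    (ℚᵘP.≃-trans (*≡* (lemma a b))
      (ℚᵘP.≃-sym (ℚᵘP.≃-trans (ℚP.toℚᵘ-homo-+ (ℤtoℚ a) (ℤtoℚ b)) (ℚᵘP.+-cong (ℤtoℚ-≃ a) (ℤtoℚ-≃ b))))))
    where
    lemma : ∀ a b → (a ℤ.+ b) ℤ.* ℤ.+ 1 ≡ (a ℤ.* ℤ.+ 1 ℤ.+ b ℤ.* ℤ.+ 1) ℤ.* ℤ.+ 1
    lemma = solve-∀

  ℤtoℚ-* : ∀ a b → ℤtoℚ (a ℤ.* b) ≡ ℤtoℚ a * ℤtoℚ b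
  ℤtoℚ-* a b = ℚP.toℚᵘ-injective (ℚᵘP.≃-trans (ℤtoℚ-≃ (a ℤ.* b))
    (ℚᵘP.≃-trans (*≡* refl)
      (ℚᵘP.≃-sym (ℚᵘP.≃-trans (ℚP.toℚᵘ-homo-* (ℤtoℚ a) (ℤtoℚ b)) (ℚᵘP.*-cong (ℤtoℚ-≃ a) (ℤtoℚ-≃ b))))))

  ℕtoℚ-+ : ∀ a b → ℕtoℚ (a ℕ.+ b) ≡ ℕtoℚ a + ℕtoℚ b
  ℕtoℚ-+ a b = trans (cong ℤtoℚ (ℤP.pos-+ a b)) (ℤtoℚ-+ (+ a) (+ b))

  ℤtoℚ-∑ₗ : ∀ {A : Set} (f : A → ℤ) xs → ∑ₗ (λ x → ℤtoℚ (f x)) xs ≡ ℤtoℚ (ℤ∑.∑ₗ f xs)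
  ℤtoℚ-∑ₗ f [] = refl
  ℤtoℚ-∑ₗ f (x ∷ xs) = trans (cong (λ s → ℤtoℚ (f x) + s) (ℤtoℚ-∑ₗ f xs)) (sym (ℤtoℚ-+ (f x) _))

  ℕtoℚ-∑ₗ : ∀ {A : Set} (f : A → ℕ) xs → ∑ₗ (λ x → ℕtoℚ (f x)) xs ≡ ℕtoℚ (ℕ∑.∑ₗ f xs)
  ℕtoℚ-∑ₗ f [] = refl
  ℕtoℚ-∑ₗ f (x ∷ xs) = trans (cong (λ s → ℕtoℚ (f x) + s) (ℕtoℚ-∑ₗ f xs)) (sym (ℕtoℚ-+ (f x) _))

  1/suc : ℕ → ℚ
  1/suc b = (+ 1) ℚ./ suc b

  /ℕ-suc : ∀ a b → a /ℕ suc b ≡ ℕtoℚ a * 1/suc b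
  /ℕ-suc a b = ℚP.toℚᵘ-injective (ℚᵘP.≃-trans (ℚP.toℚᵘ-fromℚᵘ (mkℚᵘ (+ a) b))
    (ℚᵘP.≃-trans (*≡* (lemma a b)) (ℚᵘP.≃-sym (ℚᵘP.≃-trans (ℚP.toℚᵘ-homo-* (ℕtoℚ a) (1/suc b))
       (ℚᵘP.*-cong (ℤtoℚ-≃ (+ a)) (ℚP.toℚᵘ-fromℚᵘ (mkℚᵘ (+ 1) b)))))))
    where
    lemma : ∀ a b → + a ℤ.* + suc (b ℕ.+ 0) ≡ (+ a ℤ.* ℤ.+ 1) ℤ.* + suc b
    lemma a b rewrite ℕP.+-identityʳ b = ring (+ a) (+ suc b)
      where
      ring : ∀ x y → x ℤ.* y ≡ x ℤ.* ℤ.+ 1 ℤ.* y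
      ring = solve-∀

  suc*1/suc : ∀ b → ℕtoℚ (suc b) * 1/suc b ≡ 1ℚ
  suc*1/suc b = trans (sym (/ℕ-suc (suc b) b))
    (ℚP.fromℚᵘ-cong {mkℚᵘ (+ suc b) b} {mkℚᵘ (+ 1) 0} (*≡* (ℤP.*-comm (+ suc b) (+ 1))))

  ∑-neg : ∀ {m} (f : Fin m → ℚ) → ∑[ i < m ] (- f i) ≡ - sum f
  ∑-neg {zero} f = refl
  ∑-neg {suc m} f = trans (cong (λ s → - f Fin.zero + s) (∑-neg (f ∘ Fin.suc))) (sym (ℚP.neg-distrib-+ (f Fin.zero) _))
    where open import Function using (_∘_)

  ∑-distrib-- : ∀ {m} (f g : Fin m → ℚ) → ∑[ i < m ] (f i - g i) ≡ sum f - sum g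
  ∑-distrib-- f g = trans (∑-distrib-+ f (λ i → - g i)) (cong (λ s → sum f + s) (∑-neg g))

  ∑-indicator : ∀ c N (h : ℕ → ℚ) → c < N → ∑[ j < N ] (ℕtoℚ (𝟙 (c ≡ᵇ toℕ j)) * h (toℕ j)) ≡ h c
  ∑-indicator zero (suc N) h _ =
    trans (cong₂ _+_ (ℚP.*-identityˡ (h 0)) (trans (sum-cong-≗ {N} (λ j → ℚP.*-zeroˡ (h (suc (toℕ j))))) (sum-replicate-zero N)))
          (ℚP.+-identityʳ (h 0))
  ∑-indicator (suc c) (suc N) h (s≤s c<N) =
    trans (cong₂ _+_ (ℚP.*-zeroˡ (h 0)) (∑-indicator c N (λ j → h (suc j)) c<N)) (ℚP.+-identityˡ _)

  ∑-count : ∀ {A : Set} (κ : A → ℕ) n (h : ℕ → ℚ) xs → (∀ x → κ x ≤ n) →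
    ∑[ j < suc n ] (ℕtoℚ (ℕ∑.∑ₗ (λ x → 𝟙 (κ x ≡ᵇ toℕ j)) xs) * h (toℕ j)) ≡ ∑ₗ (λ x → h (κ x)) xs
  ∑-count κ n h xs κ≤n = begin
    ∑[ j < suc n ] (ℕtoℚ (ℕ∑.∑ₗ (λ x → 𝟙 (κ x ≡ᵇ toℕ j)) xs) * h (toℕ j))
      ≡⟨ sum-cong-≗ {suc n} (λ j → trans (cong (_* h (toℕ j)) (sym (ℕtoℚ-∑ₗ (λ x → 𝟙 (κ x ≡ᵇ toℕ j)) xs)))
                                       (*-distribʳ-∑ₗ (h (toℕ j)) (λ x → ℕtoℚ (𝟙 (κ x ≡ᵇ toℕ j))) xs)) ⟩
    ∑[ j < suc n ] ∑ₗ (λ x → ℕtoℚ (𝟙 (κ x ≡ᵇ toℕ j)) * h (toℕ j)) xs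
      ≡⟨ sym (∑ₗ-∑-comm (λ x (j : Fin (suc n)) → ℕtoℚ (𝟙 (κ x ≡ᵇ toℕ j)) * h (toℕ j)) xs) ⟩
    ∑ₗ (λ x → ∑[ j < suc n ] (ℕtoℚ (𝟙 (κ x ≡ᵇ toℕ j)) * h (toℕ j))) xs
      ≡⟨ ∑ₗ-cong (λ x → ∑-indicator (κ x) (suc n) h (s≤s (κ≤n x))) xs ⟩
    ∑ₗ (λ x → h (κ x)) xs ∎
    where open ≡-Reasoning

  Σ[0⋯]≡∑ : ∀ n f → Σ[ 0 ⋯ n ] f ≡ ∑[ j < suc n ] f (toℕ j)
  Σ[0⋯]≡∑ n f = ∑ₗ-applyUpTo f (λ i → i) (suc n)

  Σ[1⋯]≡∑ : ∀ n f → Σ[ 1 ⋯ n ] f ≡ ∑[ j < n ] f (suc (toℕ j))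
  Σ[1⋯]≡∑ n f = ∑ₗ-applyUpTo (λ k → f (suc k)) (λ i → i) n

module PowerMoments where

  open CharlierPolynomial using (eval; Poly<; Charlier-leading)
  open RationalSums using (ℤtoℚ-+; ℤtoℚ-*)
  open import Defs
  open import Algebra.Bundles using (CommutativeRing)
  open import Data.Empty using (⊥-elim)
  open import Data.Fin as Fin using (toℕ)
  open import Data.Integer as ℤ using (ℤ; +_)
  import Data.Integer.Properties as ℤP
  open import Data.Integer.Tactic.RingSolver using (solve-∀)
  open import Data.List using ([]; _∷_; length)
  open import Data.Nat as ℕ using (ℕ; zero; suc; _≤_; _<_; s≤s; z≤n)
  open import Data.Nat.Properties using (≤-refl; ≤-trans; <⇒≤; m<m+n; +-suc; m≤n⇒m<n∨m≡n; m≤n⇒m≤1+n; <-irrefl; ≤-pred)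
  open import Data.Product using (_,_)
  open import Data.Rational as ℚ using (ℚ; 0ℚ; 1ℚ; _+_; _*_)
  import Data.Rational.Properties as ℚP
  open import Data.Sum using (inj₁; inj₂)
  open import Function using (_⇔_; mk⇔)
  open import Relation.Binary.PropositionalEquality

  open ListSum (CommutativeRing.commutativeSemiring ℚP.+-*-commutativeRing)

  power : ℕ → ℕ → ℚ
  power i j = ℕtoℚ (j ℕ.^ i)

  pos-^ : ∀ j k → (+ j) ℤ.^ k ≡ + (j ℕ.^ k)
  pos-^ j zero = refl
  pos-^ j (suc k) = trans (cong (+ j ℤ.*_) (pos-^ j k)) (sym (ℤP.pos-* j (j ℕ.^ k)))

  sgn-involutive : ∀ i → sgn i ℤ.* sgn i ≡ + 1
  sgn-involutive zero = refl
  sgn-involutive (suc i) = trans (lemma (sgn i)) (sgn-involutive i)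
    where
    lemma : ∀ s → ℤ.- s ℤ.* ℤ.- s ≡ s ℤ.* s
    lemma = solve-∀

  sgn-*-cancel : ∀ k {x} → ℤtoℚ (sgn k) * x ≡ 0ℚ → x ≡ 0ℚ
  sgn-*-cancel k {x} sx≡0 = begin
    x             ≡⟨ sym (ℚP.*-identityˡ x) ⟩
    1ℚ * x        ≡⟨ cong (_* x) (sym (trans (sym (ℤtoℚ-* (sgn k) (sgn k))) (cong ℤtoℚ (sgn-involutive k)))) ⟩
    s * s * x     ≡⟨ ℚP.*-assoc s s x ⟩
    s * (s * x)   ≡⟨ cong (s *_) sx≡0 ⟩
    s * 0ℚ        ≡⟨ ℚP.*-zeroʳ s ⟩
    0ℚ ∎
    where
    open ≡-Reasoning
    s = ℤtoℚ (sgn k)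

  module LinearFunctional (n : ℕ) (w : ℕ → ℚ) where

    L : (ℕ → ℚ) → ℚ
    L h = ∑[ j < suc n ] (w (toℕ j) * h (toℕ j))

    L-cong : ∀ {f g} → (∀ j → f j ≡ g j) → L f ≡ L g
    L-cong f≗g = sum-cong-≗ {suc n} (λ j → cong (w (toℕ j) *_) (f≗g (toℕ j)))

    L-+ : ∀ f g → L (λ j → f j + g j) ≡ L f + L g
    L-+ f g = trans (sum-cong-≗ {suc n} (λ j → ℚP.*-distribˡ-+ (w (toℕ j)) (f (toℕ j)) (g (toℕ j))))
                    (∑-distrib-+ {suc n} (λ j → w (toℕ j) * f (toℕ j)) (λ j → w (toℕ j) * g (toℕ j)))

    L-* : ∀ c f → L (λ j → c * f j) ≡ c * L f
    L-* c f = trans (sum-cong-≗ {suc n} (λ j → x∙yz≈y∙xz (w (toℕ j)) c (f (toℕ j))))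
                    (sym (*-distribˡ-sum {suc n} c (λ j → w (toℕ j) * f (toℕ j))))
      where
      open import Algebra.Properties.CommutativeSemigroup
        (CommutativeRing.*-commutativeSemigroup ℚP.+-*-commutativeRing) using (x∙yz≈y∙xz)

    L-zero : L (λ _ → 0ℚ) ≡ 0ℚ
    L-zero = trans (sum-cong-≗ {suc n} (λ j → ℚP.*-zeroʳ (w (toℕ j)))) (sum-replicate-zero (suc n))

    Ĉ : ℕ → ℕ → ℚ
    Ĉ k j = ℤtoℚ (Charlierhat n k j)

    module _ (∑w≡0 : ∑[ j < suc n ] w (toℕ j) ≡ 0ℚ) where

      L-power-zero : L (power 0) ≡ 0ℚ
      L-power-zero = trans (sum-cong-≗ {suc n} (λ j → ℚP.*-identityʳ (w (toℕ j)))) ∑w≡0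

      L-eval : ∀ d cs → (∀ e → d ≤ e → e < d ℕ.+ length cs → L (power e) ≡ 0ℚ) →
               L (λ j → power d j * ℤtoℚ (eval cs (+ j))) ≡ 0ℚ
      L-eval d [] _ = trans (L-cong (λ j → ℚP.*-zeroʳ (power d j))) L-zero
      L-eval d (c ∷ cs) vanish = begin
        L (λ j → power d j * ℤtoℚ (eval (c ∷ cs) (+ j)))
          ≡⟨ L-cong expand ⟩
        L (λ j → ℤtoℚ c * power d j + power (suc d) j * ℤtoℚ (eval cs (+ j)))
          ≡⟨ L-+ (λ j → ℤtoℚ c * power d j) (λ j → power (suc d) j * ℤtoℚ (eval cs (+ j))) ⟩
        L (λ j → ℤtoℚ c * power d j) + L (λ j → power (suc d) j * ℤtoℚ (eval cs (+ j)))
          ≡⟨ cong₂ _+_ (trans (L-* (ℤtoℚ c) (power d))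
                              (trans (cong (ℤtoℚ c *_) (vanish d ≤-refl (m<m+n d (s≤s z≤n)))) (ℚP.*-zeroʳ (ℤtoℚ c))))
                       (L-eval (suc d) cs (λ e d<e e< → vanish e (<⇒≤ d<e) (subst (e <_) (sym (+-suc d (length cs))) e<))) ⟩
        0ℚ + 0ℚ
          ≡⟨ ℚP.+-identityˡ 0ℚ ⟩
        0ℚ ∎
        where
        open ≡-Reasoning
        expand : ∀ j → power d j * ℤtoℚ (eval (c ∷ cs) (+ j)) ≡ ℤtoℚ c * power d j + power (suc d) j * ℤtoℚ (eval cs (+ j))
        expand j = begin
          ℤtoℚ X * ℤtoℚ (c ℤ.+ + j ℤ.* E)
            ≡⟨ sym (ℤtoℚ-* X _) ⟩
          ℤtoℚ (X ℤ.* (c ℤ.+ + j ℤ.* E))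
            ≡⟨ cong ℤtoℚ (lemma X c (+ j) E) ⟩
          ℤtoℚ (c ℤ.* X ℤ.+ (+ j ℤ.* X) ℤ.* E)
            ≡⟨ trans (ℤtoℚ-+ (c ℤ.* X) ((+ j ℤ.* X) ℤ.* E)) (cong₂ _+_ (ℤtoℚ-* c X) (ℤtoℚ-* (+ j ℤ.* X) E)) ⟩
          ℤtoℚ c * ℤtoℚ X + ℤtoℚ (+ j ℤ.* X) * ℤtoℚ E
            ≡⟨ cong (λ y → ℤtoℚ c * ℤtoℚ X + ℤtoℚ y * ℤtoℚ E) (sym (ℤP.pos-* j (j ℕ.^ d))) ⟩
          ℤtoℚ c * power d j + power (suc d) j * ℤtoℚ E ∎
          where
          X = + (j ℕ.^ d)
          E = eval cs (+ j)
          lemma : ∀ X c J E → X ℤ.* (c ℤ.+ J ℤ.* E) ≡ c ℤ.* X ℤ.+ (J ℤ.* X) ℤ.* E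
          lemma = solve-∀

      L-Poly< : ∀ k {h} → (∀ e → e < k → L (power e) ≡ 0ℚ) → Poly< k h → L (λ j → ℤtoℚ (h (+ j))) ≡ 0ℚ
      L-Poly< k vanish (cs , len≤k , h≡) =
        trans (L-cong (λ j → trans (cong ℤtoℚ (h≡ (+ j))) (sym (ℚP.*-identityˡ _))))
              (L-eval 0 cs (λ e _ e< → vanish e (≤-trans e< len≤k)))

      L-Ĉ : ∀ k → (∀ e → e < k → L (power e) ≡ 0ℚ) → L (Ĉ k) ≡ ℤtoℚ (sgn k) * L (power k)
      L-Ĉ k vanish = begin
        L (Ĉ k)
          ≡⟨ L-cong split ⟩
        L (λ j → ℤtoℚ (sgn k) * power k j + ℤtoℚ (lower (+ j)))
          ≡⟨ L-+ (λ j → ℤtoℚ (sgn k) * power k j) (λ j → ℤtoℚ (lower (+ j))) ⟩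
        L (λ j → ℤtoℚ (sgn k) * power k j) + L (λ j → ℤtoℚ (lower (+ j)))
          ≡⟨ cong₂ _+_ (L-* (ℤtoℚ (sgn k)) (power k)) (L-Poly< k vanish (Charlier-leading (+ n) k)) ⟩
        ℤtoℚ (sgn k) * L (power k) + 0ℚ
          ≡⟨ ℚP.+-identityʳ _ ⟩
        ℤtoℚ (sgn k) * L (power k) ∎
        where
        open ≡-Reasoning
        lower : ℤ → ℤ
        lower x = Charlier k (+ n ℤ.- x) ℤ.- sgn k ℤ.* x ℤ.^ k
        split : ∀ j → Ĉ k j ≡ ℤtoℚ (sgn k) * power k j + ℤtoℚ (lower (+ j))
        split j = begin
          ℤtoℚ (Charlierhat n k j)
            ≡⟨ cong ℤtoℚ (lemma (Charlierhat n k j) (sgn k) ((+ j) ℤ.^ k)) ⟩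
          ℤtoℚ (sgn k ℤ.* (+ j) ℤ.^ k ℤ.+ lower (+ j))
            ≡⟨ trans (ℤtoℚ-+ (sgn k ℤ.* (+ j) ℤ.^ k) (lower (+ j)))
                     (cong (_+ ℤtoℚ (lower (+ j))) (trans (ℤtoℚ-* (sgn k) ((+ j) ℤ.^ k))
                                                          (cong (λ y → ℤtoℚ (sgn k) * ℤtoℚ y) (pos-^ j k)))) ⟩
          ℤtoℚ (sgn k) * power k j + ℤtoℚ (lower (+ j)) ∎
          where
          lemma : ∀ C s X → C ≡ s ℤ.* X ℤ.+ (C ℤ.- s ℤ.* X)
          lemma = solve-∀

      powers⇒Ĉ : ∀ t → (∀ i → 1 ≤ i → i ≤ t → L (power i) ≡ 0ℚ) → ∀ k → 1 ≤ k → k ≤ t → L (Ĉ k) ≡ 0ℚ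
      powers⇒Ĉ t powers k 1≤k k≤t =
        trans (L-Ĉ k (λ e e<k → upTo e (≤-trans (<⇒≤ e<k) k≤t)))
              (trans (cong (ℤtoℚ (sgn k) *_) (powers k 1≤k k≤t)) (ℚP.*-zeroʳ (ℤtoℚ (sgn k))))
        where
        upTo : ∀ e → e ≤ t → L (power e) ≡ 0ℚ
        upTo zero _ = L-power-zero
        upTo (suc e) e<t = powers (suc e) (s≤s z≤n) e<t

      Ĉ⇒powers : ∀ t → (∀ k → 1 ≤ k → k ≤ t → L (Ĉ k) ≡ 0ℚ) → ∀ i → 1 ≤ i → i ≤ t → L (power i) ≡ 0ℚ
      Ĉ⇒powers zero _ i 1≤i i≤0 = ⊥-elim (<-irrefl refl (≤-trans 1≤i i≤0))
      Ĉ⇒powers (suc t) Ĉs i 1≤i i≤1+t with m≤n⇒m<n∨m≡n i≤1+t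
      ... | inj₁ i<1+t = below i 1≤i (≤-pred i<1+t)
        where
        below = Ĉ⇒powers t (λ k 1≤k k≤t → Ĉs k 1≤k (m≤n⇒m≤1+n k≤t))
      ... | inj₂ refl = sgn-*-cancel (suc t) (trans (sym (L-Ĉ (suc t) upTo)) (Ĉs (suc t) 1≤i ≤-refl))
        where
        below = Ĉ⇒powers t (λ k 1≤k k≤t → Ĉs k 1≤k (m≤n⇒m≤1+n k≤t))
        upTo : ∀ e → e < suc t → L (power e) ≡ 0ℚ
        upTo zero _ = L-power-zero
        upTo (suc e) (s≤s e<t) = below (suc e) (s≤s z≤n) e<t

      powers⇔Ĉ : ∀ t → (∀ i → 1 ≤ i → i ≤ t → L (power i) ≡ 0ℚ) ⇔ (∀ k → 1 ≤ k → k ≤ t → L (Ĉ k) ≡ 0ℚ)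
      powers⇔Ĉ t = mk⇔ (powers⇒Ĉ t) (Ĉ⇒powers t)

module Design where

  open FactorialMoments using (𝟙; length-filter-∑ₗ; ∑-fallingℕ-fixedPoints)
  open CharlierMean using (∑-Charlier-fixedPoints)
  open RationalSums
  open PowerMoments
  open import Defs
  open import Algebra.Bundles using (CommutativeRing)
  open import Data.Empty using (⊥-elim)
  open import Data.Fin as Fin using (toℕ)
  import Data.Fin.Properties
  import Data.Vec
  open import Data.Integer as ℤ using (+_)
  open import Data.List using (List; []; _∷_; length; filter; cartesianProduct; map; _++_)
  open import Data.List.Properties using (length-++; length-map; length-filter; length-tabulate)
  open import Data.Nat as ℕ using (ℕ; suc; pred; _∸_; _≤_; _<_; z≤n; _≡ᵇ_; _!) renaming (_*_ to _*ℕ_)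
  import Data.Nat.Properties as ℕP
  open import Data.Product using (proj₁; proj₂; _,_)
  open import Data.Rational as ℚ using (ℚ; 0ℚ; 1ℚ; _+_; _*_; _-_; -_)
  import Data.Rational.Properties as ℚP
  open import Data.Rational.Solver using (module +-*-Solver)
  open import Function using (_⇔_; mk⇔; Equivalence)
  open import Relation.Binary.PropositionalEquality
  open import Relation.Nullary.Decidable using (does-⇔)

  open ListSum (CommutativeRing.commutativeSemiring ℚP.+-*-commutativeRing)
  open import Algebra.Properties.Group (CommutativeRing.+-group ℚP.+-*-commutativeRing) using (x∙y⁻¹≈ε⇒x≈y; x≈y⇒x∙y⁻¹≈ε)
  private
    module ℕ∑ = ListSum ℕP.+-*-commutativeSemiring

  ≡⇔difference≡0 : ∀ {a b a′ b′ c} → a ≡ a′ → b ≡ b′ → c ≡ a′ - b′ → (a ≡ b) ⇔ (c ≡ 0ℚ)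
  ≡⇔difference≡0 refl refl refl = mk⇔ x≈y⇒x∙y⁻¹≈ε (x∙y⁻¹≈ε⇒x≈y _ _)

  x-y≡x⇔y≡0 : ∀ {a s x y} → s ≡ a - x → y ≡ x → (s ≡ a) ⇔ (y ≡ 0ℚ)
  x-y≡x⇔y≡0 {a} {x = x} refl refl =
    mk⇔ (λ a-x≡a → trans (lemma a x) (trans (cong (λ c → a - c) a-x≡a) (ℚP.+-inverseʳ a)))
        (λ x≡0 → trans (cong (λ c → a - c) x≡0) (ℚP.+-identityʳ a))
    where
    open +-*-Solver
    lemma : ∀ a x → x ≡ a - (a - x)
    lemma = solve 2 (λ a x → x := a :- (a :- x)) refl

  ∑ₗ-const : ∀ {A : Set} (c : ℚ) (xs : List A) → ∑ₗ (λ _ → c) xs ≡ ℕtoℚ (length xs) * c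
  ∑ₗ-const c [] = sym (ℚP.*-zeroˡ c)
  ∑ₗ-const c (x ∷ xs) = begin
    c + ∑ₗ (λ _ → c) xs                   ≡⟨ cong₂ _+_ (sym (ℚP.*-identityˡ c)) (∑ₗ-const c xs) ⟩
    1ℚ * c + ℕtoℚ (length xs) * c         ≡⟨ sym (ℚP.*-distribʳ-+ c 1ℚ (ℕtoℚ (length xs))) ⟩
    (1ℚ + ℕtoℚ (length xs)) * c           ≡⟨ cong (_* c) (sym (ℕtoℚ-+ 1 (length xs))) ⟩
    ℕtoℚ (suc (length xs)) * c ∎
    where open ≡-Reasoning

  ∑ₗ-one : ∀ {A : Set} (xs : List A) → ℕ∑.∑ₗ (λ _ → 1) xs ≡ length xs
  ∑ₗ-one [] = refl
  ∑ₗ-one (x ∷ xs) = cong suc (∑ₗ-one xs)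

  length-cartesianProduct : ∀ {A B : Set} (xs : List A) (ys : List B) →
    length (cartesianProduct xs ys) ≡ length xs *ℕ length ys
  length-cartesianProduct [] ys = refl
  length-cartesianProduct (x ∷ xs) ys =
    trans (length-++ (map (x ,_) ys)) (cong₂ ℕ._+_ (length-map (x ,_) ys) (length-cartesianProduct xs ys))

  ∑-freq≡1 : ∀ {n} (D : List (Perm n)) → D ≢ [] → ∑[ j < suc n ] freq D (toℕ j) ≡ 1ℚ
  ∑-freq≡1 [] D≢[] = ⊥-elim (D≢[] refl)
  ∑-freq≡1 {n} D@(x ∷ D′) _ = begin
    ∑[ j < suc n ] freq D (toℕ j)
      ≡⟨ sum-cong-≗ {suc n} (λ j → trans (/ℕ-suc (count (toℕ j)) M)
                                              (cong (λ c → ℕtoℚ c * 1/suc M) (length-filter-∑ₗ (λ p → distance p ℕ.≟ toℕ j) pairs))) ⟩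
    ∑[ j < suc n ] (ℕtoℚ (ℕ∑.∑ₗ (λ p → 𝟙 (distance p ≡ᵇ toℕ j)) pairs) * 1/suc M)
      ≡⟨ ∑-count distance n (λ _ → 1/suc M) pairs (λ p → ℕP.m∸n≤m n (F (proj₁ p ∘ₚ inv (proj₂ p)))) ⟩
    ∑ₗ (λ _ → 1/suc M) pairs
      ≡⟨ ∑ₗ-const (1/suc M) pairs ⟩
    ℕtoℚ (length pairs) * 1/suc M
      ≡⟨ cong (λ l → ℕtoℚ l * 1/suc M) (length-cartesianProduct D D) ⟩
    ℕtoℚ (suc M) * 1/suc M
      ≡⟨ suc*1/suc M ⟩
    1ℚ ∎
    where
    open ≡-Reasoning
    pairs = cartesianProduct D D
    distance = λ (p : Perm n Data.Product.× Perm n) → dS (proj₁ p) (proj₂ p)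
    count : ℕ → ℕ
    count i = length (filter (λ p → distance p ℕ.≟ i) pairs)
    -- length D *ℕ length D reduces to suc M, which makes freq D j = count j /ℕ suc M.
    M = length D′ ℕ.+ length D′ *ℕ suc (length D′)

  uniform : ℕ → ℕ → ℚ
  uniform n j = v n j /ℕ (n !)

  F≤n : ∀ {n} (σ : Perm n) → F σ ≤ n
  F≤n {n} σ = ℕP.≤-trans (length-filter (λ i → Data.Vec.lookup σ i Data.Fin.Properties.≟ i) (Data.List.allFin n))
                         (ℕP.≤-reflexive (length-tabulate (λ i → i)))

  ≡ᵇ-∸-flip : ∀ n f j → f ≤ n → j ≤ n → (f ≡ᵇ n ∸ j) ≡ (n ∸ f ≡ᵇ j)
  ≡ᵇ-∸-flip n f j f≤n j≤n = does-⇔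
    (mk⇔ (λ f≡n-j → trans (cong (n ∸_) f≡n-j) (ℕP.m∸[m∸n]≡n j≤n))
         (λ n-f≡j → trans (sym (ℕP.m∸[m∸n]≡n f≤n)) (cong (n ∸_) n-f≡j)))
    (f ℕ.≟ n ∸ j) (n ∸ f ℕ.≟ j)

  ∑-uniform : ∀ n (h : ℕ → ℚ) →
    ∑[ j < suc n ] (uniform n (toℕ j) * h (toℕ j)) ≡ 1/suc (pred (n !)) * ∑ₗ (λ σ → h (n ∸ F σ)) (Sn n)
  ∑-uniform n h = begin
    ∑[ j < suc n ] (uniform n (toℕ j) * h (toℕ j))
      ≡⟨ sum-cong-≗ {suc n} (λ j → trans (cong (_* h (toℕ j)) (weight (toℕ j) (ℕP.≤-pred (Data.Fin.Properties.toℕ<n j))))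
                                         (trans (ℚP.*-assoc (ℕtoℚ (count (toℕ j))) r (h (toℕ j)))
                                                (x∙yz≈y∙xz (ℕtoℚ (count (toℕ j))) r (h (toℕ j))))) ⟩
    ∑[ j < suc n ] (r * (ℕtoℚ (count (toℕ j)) * h (toℕ j)))
      ≡⟨ sym (*-distribˡ-sum {suc n} r (λ j → ℕtoℚ (count (toℕ j)) * h (toℕ j))) ⟩
    r * ∑[ j < suc n ] (ℕtoℚ (count (toℕ j)) * h (toℕ j))
      ≡⟨ cong (r *_) (∑-count (λ σ → n ∸ F σ) n h (Sn n) (λ σ → ℕP.m∸n≤m n (F σ))) ⟩
    r * ∑ₗ (λ σ → h (n ∸ F σ)) (Sn n) ∎
    where
    open ≡-Reasoning
    open import Algebra.Properties.CommutativeSemigroup (CommutativeRing.*-commutativeSemigroup ℚP.+-*-commutativeRing) using (x∙yz≈y∙xz)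
    r = 1/suc (pred (n !))
    count : ℕ → ℕ
    count j = ℕ∑.∑ₗ (λ σ → 𝟙 (n ∸ F σ ≡ᵇ j)) (Sn n)
    weight : ∀ j → j ≤ n → uniform n j ≡ ℕtoℚ (count j) * r
    weight j j≤n = begin
      v n j /ℕ (n !)
        ≡⟨ cong (v n j /ℕ_) (sym (ℕP.suc-pred (n !) {{n ℕP.!≢0}})) ⟩
      v n j /ℕ suc (pred (n !))
        ≡⟨ /ℕ-suc (v n j) (pred (n !)) ⟩
      ℕtoℚ (v n j) * r
        ≡⟨ cong (λ c → ℕtoℚ c * r) (trans (length-filter-∑ₗ (λ σ → F σ ℕ.≟ n ∸ j) (Sn n))
                                          (ℕ∑.∑ₗ-cong (λ σ → cong 𝟙 (≡ᵇ-∸-flip n (F σ) j (F≤n σ) j≤n)) (Sn n))) ⟩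
      ℕtoℚ (count j) * r ∎

  length-Sn : ∀ n → length (Sn n) ≡ n !
  length-Sn n = trans (sym (∑ₗ-one (Sn n))) (∑-fallingℕ-fixedPoints n 0 z≤n)

  ∑-uniform≡1 : ∀ n → ∑[ j < suc n ] uniform n (toℕ j) ≡ 1ℚ
  ∑-uniform≡1 n = begin
    ∑[ j < suc n ] uniform n (toℕ j)
      ≡⟨ sum-cong-≗ {suc n} (λ j → sym (ℚP.*-identityʳ (uniform n (toℕ j)))) ⟩
    ∑[ j < suc n ] (uniform n (toℕ j) * 1ℚ)
      ≡⟨ ∑-uniform n (λ _ → 1ℚ) ⟩
    r * ∑ₗ (λ _ → 1ℚ) (Sn n)
      ≡⟨ cong (r *_) (trans (∑ₗ-const 1ℚ (Sn n)) (ℚP.*-identityʳ _)) ⟩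
    r * ℕtoℚ (length (Sn n))
      ≡⟨ cong (λ l → r * ℕtoℚ l) (trans (length-Sn n) (sym (ℕP.suc-pred (n !) {{n ℕP.!≢0}}))) ⟩
    r * ℕtoℚ (suc (pred (n !)))
      ≡⟨ trans (ℚP.*-comm r _) (suc*1/suc (pred (n !))) ⟩
    1ℚ ∎
    where
    open ≡-Reasoning
    r = 1/suc (pred (n !))

  pos-∸ : ∀ n f → f ≤ n → + n ℤ.- + (n ∸ f) ≡ + f
  pos-∸ n f f≤n = trans (ℤP.m-n≡m⊖n n (n ∸ f)) (trans (ℤP.⊖-≥ (ℕP.m∸n≤m n f)) (cong +_ (ℕP.m∸[m∸n]≡n f≤n)))
    where import Data.Integer.Properties as ℤP

  ∑-uniform-Ĉ≡0 : ∀ n k → 1 ≤ k → k ≤ n → ∑[ j < suc n ] (uniform n (toℕ j) * ℤtoℚ (Charlierhat n k (toℕ j))) ≡ 0ℚ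
  ∑-uniform-Ĉ≡0 n k 1≤k k≤n = begin
    ∑[ j < suc n ] (uniform n (toℕ j) * ℤtoℚ (Charlierhat n k (toℕ j)))
      ≡⟨ ∑-uniform n (λ j → ℤtoℚ (Charlierhat n k j)) ⟩
    r * ∑ₗ (λ σ → ℤtoℚ (Charlier k (+ n ℤ.- + (n ∸ F σ)))) (Sn n)
      ≡⟨ cong (r *_) (∑ₗ-cong (λ σ → cong (λ x → ℤtoℚ (Charlier k x)) (pos-∸ n (F σ) (F≤n σ))) (Sn n)) ⟩
    r * ∑ₗ (λ σ → ℤtoℚ (Charlier k (+ F σ))) (Sn n)
      ≡⟨ cong (r *_) (trans (ℤtoℚ-∑ₗ (λ σ → Charlier k (+ F σ)) (Sn n))
                            (cong ℤtoℚ (∑-Charlier-fixedPoints n k 1≤k k≤n))) ⟩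
    r * 0ℚ
      ≡⟨ ℚP.*-zeroʳ r ⟩
    0ℚ ∎
    where
    open ≡-Reasoning
    r = 1/suc (pred (n !))

  ⇔-∀≤ : ∀ {P Q : ℕ → Set} t → (∀ i → 1 ≤ i → i ≤ t → P i ⇔ Q i) →
         (∀ i → 1 ≤ i → i ≤ t → P i) ⇔ (∀ i → 1 ≤ i → i ≤ t → Q i)
  ⇔-∀≤ t P⇔Q = mk⇔ (λ p i 1≤i i≤t → Equivalence.to (P⇔Q i 1≤i i≤t) (p i 1≤i i≤t))
                   (λ q i 1≤i i≤t → Equivalence.from (P⇔Q i 1≤i i≤t) (q i 1≤i i≤t))

  module _ {n : ℕ} (D : List (Perm n)) (D≢[] : D ≢ []) where

    open LinearFunctional n (λ j → freq D j - uniform n j)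
    open +-*-Solver

    ∑w≡0 : ∑[ j < suc n ] (freq D (toℕ j) - uniform n (toℕ j)) ≡ 0ℚ
    ∑w≡0 = trans (∑-distrib-- {suc n} (λ j → freq D (toℕ j)) (λ j → uniform n (toℕ j)))
                 (trans (cong₂ _-_ (∑-freq≡1 D D≢[]) (∑-uniform≡1 n)) (ℚP.+-inverseʳ 1ℚ))

    L-split : ∀ h → L h ≡ ∑[ j < suc n ] (freq D (toℕ j) * h (toℕ j)) - ∑[ j < suc n ] (uniform n (toℕ j) * h (toℕ j))
    L-split h = trans (sum-cong-≗ {suc n} (λ j → distrib (freq D (toℕ j)) (uniform n (toℕ j)) (h (toℕ j))))
                      (∑-distrib-- {suc n} (λ j → freq D (toℕ j) * h (toℕ j)) (λ j → uniform n (toℕ j) * h (toℕ j)))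
      where
      distrib : ∀ f u h → (f - u) * h ≡ f * h - u * h
      distrib = solve 3 (λ f u h → (f :- u) :* h := f :* h :- u :* h) refl

    design⇔powers : ∀ t → IsDesign t D ⇔ (∀ i → 1 ≤ i → i ≤ t → L (power i) ≡ 0ℚ)
    design⇔powers t = ⇔-∀≤ t λ i _ _ →
      ≡⇔difference≡0 (Σ[0⋯]≡∑ n (λ j → freq D j * power i j)) (Σ[0⋯]≡∑ n (λ j → uniform n j * power i j))
                     (L-split (power i))

    condition⇔Ĉ : ∀ t → t ≤ n →
      (∀ k → 1 ≤ k → k ≤ t →
        Σ[ 1 ⋯ n ] (λ i → freq D i * (ℤtoℚ (Charlierhat n k 0) - ℤtoℚ (Charlierhat n k i))) ≡ ℤtoℚ (Charlierhat n k 0))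
      ⇔ (∀ k → 1 ≤ k → k ≤ t → L (Ĉ k) ≡ 0ℚ)
    condition⇔Ĉ t t≤n = ⇔-∀≤ t λ k 1≤k k≤t → x-y≡x⇔y≡0 (Σ≡c₀-X k) (L-Ĉ≡X k 1≤k (ℕP.≤-trans k≤t t≤n))
      where
      X : ℕ → ℚ
      X k = ∑[ j < suc n ] (freq D (toℕ j) * Ĉ k (toℕ j))

      L-Ĉ≡X : ∀ k → 1 ≤ k → k ≤ n → L (Ĉ k) ≡ X k
      L-Ĉ≡X k 1≤k k≤n =
        trans (L-split (Ĉ k)) (trans (cong (λ u → X k - u) (∑-uniform-Ĉ≡0 n k 1≤k k≤n)) (ℚP.+-identityʳ (X k)))

      Σ≡c₀-X : ∀ k → Σ[ 1 ⋯ n ] (λ i → freq D i * (Ĉ k 0 - Ĉ k i)) ≡ Ĉ k 0 - X k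
      Σ≡c₀-X k = begin
        Σ[ 1 ⋯ n ] g
          ≡⟨ Σ[1⋯]≡∑ n g ⟩
        ∑[ j < n ] g (suc (toℕ j))
          ≡⟨ sym (trans (cong (_+ ∑[ j < n ] g (suc (toℕ j))) g0≡0) (ℚP.+-identityˡ _)) ⟩
        ∑[ j < suc n ] g (toℕ j)
          ≡⟨ sum-cong-≗ {suc n} (λ j → expand (freq D (toℕ j)) c₀ (Ĉ k (toℕ j))) ⟩
        ∑[ j < suc n ] (c₀ * freq D (toℕ j) - freq D (toℕ j) * Ĉ k (toℕ j))
          ≡⟨ ∑-distrib-- {suc n} (λ j → c₀ * freq D (toℕ j)) (λ j → freq D (toℕ j) * Ĉ k (toℕ j)) ⟩
        ∑[ j < suc n ] (c₀ * freq D (toℕ j)) - X k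
          ≡⟨ cong (_- X k) (trans (sym (*-distribˡ-sum {suc n} c₀ (λ j → freq D (toℕ j))))
                                  (trans (cong (c₀ *_) (∑-freq≡1 D D≢[])) (ℚP.*-identityʳ c₀))) ⟩
        c₀ - X k ∎
        where
        open ≡-Reasoning
        c₀ = Ĉ k 0
        g : ℕ → ℚ
        g i = freq D i * (c₀ - Ĉ k i)
        g0≡0 : g 0 ≡ 0ℚ
        g0≡0 = trans (cong (freq D 0 *_) (ℚP.+-inverseʳ c₀)) (ℚP.*-zeroʳ (freq D 0))
        expand : ∀ f c d → f * (c - d) ≡ c * f - f * d
        expand = solve 3 (λ f c d → f :* (c :- d) := c :* f :- f :* d) refl

open import Defs
open import Data.Nat using (ℕ; _≤_) renaming (_*_ to _*ℕ_; _+_ to _+ℕ_)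
open import Data.Nat.Properties using (≤-trans; m≤m+n)
open import Data.List using (List; [])
open import Data.List.Relation.Unary.All using (All)
open import Data.List.Relation.Unary.Unique.Propositional using (Unique)
open import Data.Rational using (_+_; _-_; _*_)
open import Relation.Binary.PropositionalEquality using (_≡_; _≢_)
open import Function.Bundles using (_⇔_)
open import Function.Properties.Equivalence using () renaming (trans to ⇔-trans; sym to ⇔-sym)
open Design using (design⇔powers; uniform; ∑w≡0; condition⇔Ĉ)

theorem5 : (t n : ℕ) → 1 ≤ t → 2 *ℕ t ≤ n →
    (D : List (Perm n)) → All IsPerm D → Unique D → D ≢ [] →
    IsDesign t D ⇔
      (∀ k → 1 ≤ k → k ≤ t →
        Σ[ 1 ⋯ n ] (λ i → freq D i * (ℤtoℚ (Charlierhat n k 0) - ℤtoℚ (Charlierhat n k i)))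
        ≡ ℤtoℚ (Charlierhat n k 0))
theorem5 t n _ 2t≤n D _ _ D≢[] =
  ⇔-trans (design⇔powers D D≢[] t)
          (⇔-trans (PowerMoments.LinearFunctional.powers⇔Ĉ n (λ j → freq D j - uniform n j) (∑w≡0 D D≢[]) t)
                   (⇔-sym (condition⇔Ĉ D D≢[] t t≤n)))
  where
  t≤n : t ≤ n
  t≤n = ≤-trans (m≤m+n t (t +ℕ 0)) 2t≤n
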